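{- Let $0\le b\le c\le d$ be integers such that $\Gamma(0,b,c,d)$ is a simple graph, and suppose $d<b+c+3$. Then $\Gamma(0,b,c,d)$ has avoidance index $2$ if and only if it is bipartite.
   Context: For integers $0\le a\le b\le c\le d$, $\Gamma(a,b,c,d)$ is the graph consisting of two vertices $u,v$ (each of valency 4) joined by four internally vertex-disjoint paths A, B, C, D having respectively $a,b,c,d$ internal vertices (all of valency 2); with $a=0$, $u$ and $v$ are adjacent. Graphs are simple. An Eulerian circuit is a closed trail traversing every edge exactly once. For an Eulerian graph with $m$ edges and vertex $x$, two Eulerian circuits $x,v_1,\ldots,v_{m-1},x$ and $x,w_1,\ldots,w_{m-1},x$ are avoiding if for each $1\le i\le m-1$, $v_i\ne w_i$ and $v_i,w_i$ are non-adjacent; a set of Eulerian circuits is mutually avoiding if they are pairwise avoiding. The avoidance index $\mathrm{av}(G)$ of an Eulerian graph $G$ is the largest $k$ such that for every vertex $x$ there is a set of $k$ mutually avoiding Eulerian circuits starting and ending at $x$. -}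

module Defs where

open import Data.Nat using (ℕ; zero; suc; _+_; _≤_; _<_; _⊓_; _⊔_)
open import Data.Bool using (Bool)
open import Data.Fin using (Fin)
open import Data.List using (List; []; _∷_; _++_; [_]; map)
open import Data.List.Membership.Propositional using (_∈_)
open import Data.List.Relation.Unary.All using (All)
open import Data.List.Relation.Unary.Unique.Propositional using (Unique)
open import Data.List.Relation.Binary.Permutation.Propositional using (_↭_)
open import Data.List.Relation.Binary.Pointwise using (Pointwise)
open import Data.Product using (_×_; _,_; Σ; ∃)
open import Data.Sum using (_⊎_)
open import Relation.Binary.PropositionalEquality using (_≡_; _≢_)
open import Relation.Nullary using (¬_)

-- A (multi)graph on vertex set {0,…,n-1}, given by its list of edges
-- (each edge an (unordered) pair, listed once per occurrence).
record Graph : Set where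
  constructor mkGraph
  field
    n     : ℕ
    edges : List (ℕ × ℕ)
open Graph public

norm : ℕ × ℕ → ℕ × ℕ
norm (a , b) = (a ⊓ b , a ⊔ b)

Simple : Graph → Set
Simple G = All (λ e → Data.Product.proj₁ e ≢ Data.Product.proj₂ e) (edges G)
         × Unique (map norm (edges G))

Adj : Graph → ℕ → ℕ → Set
Adj G a b = (a , b) ∈ edges G ⊎ (b , a) ∈ edges G

Bipartite : Graph → Set
Bipartite G = Σ (ℕ → Bool) λ col →
  All (λ e → col (Data.Product.proj₁ e) ≢ col (Data.Product.proj₂ e)) (edges G)

steps : List ℕ → List (ℕ × ℕ)
steps (a ∷ b ∷ r) = (a , b) ∷ steps (b ∷ r)
steps _ = []

-- ws = [v₁,…,v_{m-1}] : the walk x,v₁,…,v_{m-1},x is an Eulerian circuit,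
-- i.e. a closed walk traversing every edge exactly once.
EulerCircuit : Graph → ℕ → List ℕ → Set
EulerCircuit G x ws = map norm (steps (x ∷ ws ++ [ x ])) ↭ map norm (edges G)

Avoiding : Graph → List ℕ → List ℕ → Set
Avoiding G vs ws = Pointwise (λ a b → a ≢ b × ¬ Adj G a b) vs ws

HasAvoiding : Graph → ℕ → Set
HasAvoiding G k = ∀ x → x < n G →
  Σ (Fin k → List ℕ) λ C →
    (∀ i → EulerCircuit G x (C i)) × (∀ i j → i ≢ j → Avoiding G (C i) (C j))

AvIndex : Graph → ℕ → Set
AvIndex G k = HasAvoiding G k × (∀ j → HasAvoiding G j → j ≤ k)

-- edges of a u–v path (u = 0, v = 1) with k internal vertices s,…,s+k-1
pathEdges : ℕ → ℕ → List (ℕ × ℕ)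
pathEdges s zero = (0 , 1) ∷ []
pathEdges s (suc k) = (0 , s) ∷ go s k
  where
  go : ℕ → ℕ → List (ℕ × ℕ)
  go t zero = (t , 1) ∷ []
  go t (suc j) = (t , suc t) ∷ go (suc t) j

-- Γ(a,b,c,d): u = 0, v = 1, internal vertices of A, B, C, D numbered consecutively from 2
Γ : ℕ → ℕ → ℕ → ℕ → Graph
Γ a b c d = mkGraph (2 + a + b + c + d)
  (pathEdges 2 a ++ pathEdges (2 + a) b ++ pathEdges (2 + a + b) c
    ++ pathEdges (2 + a + b + c) d)

-- Γ(0,b,c,d) is bipartite iff b, c and d are even.  If some path has 2m + 1 internal
-- vertices, two avoiding circuits at its middle vertex must leave it in opposite directions;
-- both are then forced along the path and reach u and v at the same step, and u, v are
-- adjacent.  No three circuits at the first internal vertex of B avoid each other, since it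
-- has only two neighbours.  Conversely, in a bipartite graph two Eulerian circuits from the
-- same vertex have the same colour at every step, so they avoid each other as soon as they
-- never meet.  Such pairs are written down explicitly in the abstract theta graph: at u
-- (and, by the symmetry exchanging u and v, at v), and at a vertex in the lower half of a
-- path, according to whether it is the central vertex or lies below it.  The latter needs
-- the path to have fewer internal vertices than the other two paths together plus three,
-- which is where d < b + c + 3 is used.

module Submission where

open import Data.Bool using (Bool; true; false; not; _xor_)
open import Data.Bool.Properties using (¬-not; not-¬; not-distribˡ-xor; not-distribʳ-xor; not-involutive; xor-same)
open import Data.Empty using (⊥; ⊥-elim)
open import Data.Fin using (Fin; zero; suc)
open import Data.List using (List; []; _∷_; _++_; [_]; map; length; reverse; concat)
open import Data.List.Properties using (++-assoc; length-++; map-++; length-map; map-∘; map-cong; reverse-++; unfold-reverse; reverse-map; concat-map)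
open import Data.List.Membership.Propositional using (_∈_)
open import Data.List.Membership.Propositional.Properties using (∈-map⁺; ∈-map⁻; ∈-++⁻)
open import Data.List.Relation.Unary.Any using (here; there)
open import Data.List.Relation.Unary.All using (All; []; _∷_; lookup)
import Data.List.Relation.Unary.All.Properties as All
open import Data.List.Relation.Unary.Unique.Propositional using (Unique)
open import Data.List.Relation.Unary.AllPairs as AllPairs using (_∷_)
open import Data.List.Relation.Binary.Permutation.Propositional using (_↭_; ↭-sym; ↭-refl; ↭-trans; ↭-reflexive; ↭⇒↭ₛ)
open import Data.List.Relation.Binary.Permutation.Propositional.Properties using (∈-resp-↭; ↭-length; ↭-reverse; ++⁺; ++⁺ˡ; ++-commutativeMonoid)
open import Data.List.Relation.Binary.Permutation.Setoid.Properties using (Unique-resp-↭)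
open import Data.List.Relation.Binary.Pointwise as Pointwise using (Pointwise; []; _∷_; ++-cancelʳ)
open import Data.Nat using (ℕ; zero; suc; _+_; _∸_; _≤_; _<_; z≤n; s≤s; _<?_; _≤?_)
open import Data.Nat.Properties
open import Data.Nat.Tactic.RingSolver using (solve-∀)
open import Data.Product using (Σ; ∃; _×_; _,_; proj₁; proj₂; swap)
open import Data.Sum using (_⊎_; inj₁; inj₂) renaming (swap to ⊎-swap)
open import Data.Unit using (⊤; tt)
open import Function.Bundles using (_⇔_; mk⇔)
open import Relation.Binary.PropositionalEquality using (_≡_; _≢_; refl; sym; trans; cong; cong₂; subst; subst₂; setoid; ≢-sym)
open import Relation.Nullary using (yes; no)
open Relation.Binary.PropositionalEquality.≡-Reasoning

open import Defs

module _ {A : Set} where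

  pairs : List A → List (A × A)
  pairs (a ∷ b ∷ r) = (a , b) ∷ pairs (b ∷ r)
  pairs _ = []

  length-pairs : ∀ a l → length (pairs (a ∷ l)) ≡ length l
  length-pairs a [] = refl
  length-pairs a (b ∷ l) = cong suc (length-pairs b l)

  pairs-++-∷ : ∀ xs y ys → pairs (xs ++ y ∷ ys) ≡ pairs (xs ++ [ y ]) ++ pairs (y ∷ ys)
  pairs-++-∷ [] y ys = refl
  pairs-++-∷ (x ∷ []) y ys = refl
  pairs-++-∷ (x ∷ x′ ∷ xs) y ys = cong ((x , x′) ∷_) (pairs-++-∷ (x′ ∷ xs) y ys)

  pairs-reverse : ∀ l → pairs (reverse l) ≡ reverse (map swap (pairs l))
  pairs-reverse [] = refl
  pairs-reverse (x ∷ []) = refl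
  pairs-reverse (x ∷ y ∷ r) = begin
    pairs (reverse (x ∷ y ∷ r))               ≡⟨ cong pairs (unfold-reverse x (y ∷ r)) ⟩
    pairs (reverse (y ∷ r) ++ [ x ])          ≡⟨ cong (λ l → pairs (l ++ [ x ])) (unfold-reverse y r) ⟩
    pairs ((reverse r ++ [ y ]) ++ [ x ])     ≡⟨ cong pairs (++-assoc (reverse r) [ y ] [ x ]) ⟩
    pairs (reverse r ++ y ∷ [ x ])            ≡⟨ pairs-++-∷ (reverse r) y [ x ] ⟩
    pairs (reverse r ++ [ y ]) ++ [ (y , x) ] ≡⟨ cong (λ l → pairs l ++ [ (y , x) ]) (unfold-reverse y r) ⟨
    pairs (reverse (y ∷ r)) ++ [ (y , x) ]    ≡⟨ cong (_++ [ (y , x) ]) (pairs-reverse (y ∷ r)) ⟩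
    reverse (map swap (pairs (y ∷ r))) ++ [ (y , x) ] ≡⟨ unfold-reverse (y , x) (map swap (pairs (y ∷ r))) ⟨
    reverse (map swap (pairs (x ∷ y ∷ r)))    ∎

pairs-map : ∀ {A B : Set} (f : A → B) l → pairs (map f l) ≡ map (λ e → f (proj₁ e) , f (proj₂ e)) (pairs l)
pairs-map f [] = refl
pairs-map f (a ∷ []) = refl
pairs-map f (a ∷ b ∷ r) = cong ((f a , f b) ∷_) (pairs-map f (b ∷ r))

map-pairs-reverse : ∀ {A B : Set} (κ : A × A → B) → (∀ a b → κ (a , b) ≡ κ (b , a)) →
                    ∀ l → map κ (pairs (reverse l)) ↭ map κ (pairs l)
map-pairs-reverse κ κ-sym l =
  ↭-trans (↭-reflexive (trans (cong (map κ) (pairs-reverse l)) (reverse-map κ (map swap (pairs l)))))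
  (↭-trans (↭-reverse _) (↭-reflexive (trans (sym (map-∘ (pairs l))) (map-cong (λ { (a , b) → κ-sym b a }) (pairs l)))))

steps≡pairs : ∀ l → steps l ≡ pairs l
steps≡pairs [] = refl
steps≡pairs (a ∷ []) = refl
steps≡pairs (a ∷ b ∷ r) = cong ((a , b) ∷_) (steps≡pairs (b ∷ r))

unique-resp-↭ : ∀ {A : Set} {xs ys : List A} → xs ↭ ys → Unique xs → Unique ys
unique-resp-↭ {A} p = Unique-resp-↭ (setoid A) (↭⇒↭ₛ p)

range : ℕ → ℕ → List ℕ
range a zero = []
range a (suc n) = a ∷ range (suc a) n

length-range : ∀ a n → length (range a n) ≡ n
length-range a zero = refl
length-range a (suc n) = cong suc (length-range (suc a) n)

range-++ : ∀ a m n → range a (m + n) ≡ range a m ++ range (a + m) n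
range-++ a zero n = cong (λ z → range z n) (sym (+-identityʳ a))
range-++ a (suc m) n = cong (a ∷_) (trans (range-++ (suc a) m n) (cong (λ z → range (suc a) m ++ range z n) (sym (+-suc a m))))

range-snoc : ∀ a n → range a (suc n) ≡ range a n ++ [ a + n ]
range-snoc a n = trans (cong (range a) (+-comm 1 n)) (range-++ a n 1)

range-suc : ∀ a n → range (suc a) n ≡ map suc (range a n)
range-suc a zero = refl
range-suc a (suc n) = cong (suc a ∷_) (range-suc (suc a) n)

map-+-range : ∀ s a n → map (s +_) (range a n) ≡ range (s + a) n
map-+-range s a zero = refl
map-+-range s a (suc n) = cong (s + a ∷_) (trans (map-+-range s (suc a) n) (cong (λ z → range z n) (+-suc s a)))

map-∸-range : ∀ s k → map (λ j → s + (k ∸ suc j)) (range 0 k) ≡ reverse (range s k)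
map-∸-range s zero = refl
map-∸-range s (suc k) = begin
    s + k ∷ map (λ j → s + (suc k ∸ suc j)) (range 1 k)
  ≡⟨ cong (λ l → s + k ∷ map (λ j → s + (suc k ∸ suc j)) l) (range-suc 0 k) ⟩
    s + k ∷ map (λ j → s + (suc k ∸ suc j)) (map suc (range 0 k))
  ≡⟨ cong (s + k ∷_) (map-∘ (range 0 k)) ⟨
    s + k ∷ map (λ j → s + (k ∸ suc j)) (range 0 k)
  ≡⟨ cong (s + k ∷_) (map-∸-range s k) ⟩
    s + k ∷ reverse (range s k)
  ≡⟨ reverse-++ (range s k) [ s + k ] ⟨
    reverse (range s k ++ [ s + k ])
  ≡⟨ cong reverse (range-snoc s k) ⟨
    reverse (range s (suc k))
  ∎

module _ {A : Set} where

  -- A leg (r , e) runs through the vertices r and ends at e; a closed walk at x is a list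
  -- of legs whose last one ends at x.
  Leg : Set
  Leg = List A × A

  legsWalk : List Leg → List A
  legsWalk [] = []
  legsWalk ((r , e) ∷ ls) = r ++ e ∷ legsWalk ls

  legsInterior : List Leg → List A
  legsInterior [] = []
  legsInterior ((r , e) ∷ []) = r
  legsInterior ((r , e) ∷ l ∷ ls) = r ++ e ∷ legsInterior (l ∷ ls)

  legsEnd : A → List Leg → A
  legsEnd x [] = x
  legsEnd x ((r , e) ∷ ls) = legsEnd e ls

  legPairs : A → List Leg → List (List (A × A))
  legPairs x [] = []
  legPairs x ((r , e) ∷ ls) = pairs (x ∷ r ++ [ e ]) ∷ legPairs e ls

  legsInterior-++-end : ∀ x l ls → legsInterior (l ∷ ls) ++ [ legsEnd x (l ∷ ls) ] ≡ legsWalk (l ∷ ls)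
  legsInterior-++-end x (r , e) [] = refl
  legsInterior-++-end x (r , e) (l ∷ ls) =
    trans (++-assoc r (e ∷ legsInterior (l ∷ ls)) _) (cong (λ z → r ++ e ∷ z) (legsInterior-++-end e l ls))

  pairs-legsWalk : ∀ x ls → pairs (x ∷ legsWalk ls) ≡ concat (legPairs x ls)
  pairs-legsWalk x [] = refl
  pairs-legsWalk x ((r , e) ∷ ls) = trans (pairs-++-∷ (x ∷ r) e (legsWalk ls)) (cong (pairs (x ∷ r ++ [ e ]) ++_) (pairs-legsWalk e ls))

  pairs-closed-legs : ∀ x l ls → legsEnd x (l ∷ ls) ≡ x → pairs (x ∷ legsInterior (l ∷ ls) ++ [ x ]) ≡ concat (legPairs x (l ∷ ls))
  pairs-closed-legs x l ls closed = begin
    pairs (x ∷ legsInterior (l ∷ ls) ++ [ x ])                   ≡⟨ cong (λ z → pairs (x ∷ legsInterior (l ∷ ls) ++ [ z ])) closed ⟨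
    pairs (x ∷ legsInterior (l ∷ ls) ++ [ legsEnd x (l ∷ ls) ])  ≡⟨ cong (λ z → pairs (x ∷ z)) (legsInterior-++-end x l ls) ⟩
    pairs (x ∷ legsWalk (l ∷ ls))                                ≡⟨ pairs-legsWalk x (l ∷ ls) ⟩
    concat (legPairs x (l ∷ ls))                                 ∎

module _ {A : Set} where

  numbered : ℕ → List A → List (ℕ × A)
  numbered k [] = []
  numbered k (x ∷ xs) = (k , x) ∷ numbered (suc k) xs

  ∈-numbered-++⁻ : ∀ k xs ys {p} → p ∈ numbered k (xs ++ ys) → p ∈ numbered k xs ⊎ p ∈ numbered (k + length xs) ys
  ∈-numbered-++⁻ k [] ys {p} m = inj₂ (subst (λ z → p ∈ numbered z ys) (sym (+-identityʳ k)) m)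
  ∈-numbered-++⁻ k (x ∷ xs) ys (here eq) = inj₁ (here eq)
  ∈-numbered-++⁻ k (x ∷ xs) ys {p} (there m) with ∈-numbered-++⁻ (suc k) xs ys m
  ... | inj₁ m′ = inj₁ (there m′)
  ... | inj₂ m′ = inj₂ (subst (λ z → p ∈ numbered z ys) (sym (+-suc k (length xs))) m′)

  numbered-disjoint⇒≢ : ∀ k (xs ys : List A) → length xs ≡ length ys →
                         (∀ {p} → p ∈ numbered k xs → p ∈ numbered k ys → ⊥) → Pointwise _≢_ xs ys
  numbered-disjoint⇒≢ k [] [] _ _ = []
  numbered-disjoint⇒≢ k (x ∷ xs) (y ∷ ys) eq disjoint =
    (λ x≡y → disjoint (here refl) (here (cong (k ,_) x≡y)))
    ∷ numbered-disjoint⇒≢ (suc k) xs ys (suc-injective eq) (λ m₁ m₂ → disjoint (there m₁) (there m₂))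

  run↑ : (ℕ → A) → ℕ → ℕ → List A
  run↑ R a n = map R (range a n)

  run↓ : (ℕ → A) → ℕ → ℕ → List A
  run↓ R a zero = []
  run↓ R a (suc n) = R (a + n) ∷ run↓ R a n

  length-run↑ : ∀ R a n → length (run↑ R a n) ≡ n
  length-run↑ R a n = trans (length-map R (range a n)) (length-range a n)

  length-run↓ : ∀ R a n → length (run↓ R a n) ≡ n
  length-run↓ R a zero = refl
  length-run↓ R a (suc n) = cong suc (length-run↓ R a n)

  run↑-snoc : ∀ R a n → run↑ R a (suc n) ≡ run↑ R a n ++ [ R (a + n) ]
  run↑-snoc R a n = trans (cong (map R) (range-snoc a n)) (map-++ R (range a n) _)

  run↓≡reverse-run↑ : ∀ R a n → run↓ R a n ≡ reverse (run↑ R a n)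
  run↓≡reverse-run↑ R a zero = refl
  run↓≡reverse-run↑ R a (suc n) = begin
    R (a + n) ∷ run↓ R a n                  ≡⟨ cong (R (a + n) ∷_) (run↓≡reverse-run↑ R a n) ⟩
    R (a + n) ∷ reverse (run↑ R a n)        ≡⟨ reverse-++ (run↑ R a n) [ R (a + n) ] ⟨
    reverse (run↑ R a n ++ [ R (a + n) ])   ≡⟨ cong reverse (run↑-snoc R a n) ⟨
    reverse (run↑ R a (suc n))              ∎

  run↑-split : ∀ R i h → run↑ R 0 (i + suc h) ≡ run↑ R 0 i ++ R i ∷ run↑ R (suc i) h
  run↑-split R i h = trans (cong (map R) (range-++ 0 i (suc h))) (map-++ R (range 0 i) _)

  All-run↑ : ∀ {Q : A → Set} R a n → (∀ {j} → j < a + n → Q (R j)) → All Q (run↑ R a n)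
  All-run↑ R a zero q = []
  All-run↑ R a (suc n) q = q (m<m+n a (s≤s z≤n)) ∷ All-run↑ R (suc a) n (λ {j} j< → q (subst (j <_) (sym (+-suc a n)) j<))

  All-run↓ : ∀ {Q : A → Set} R a n → (∀ {j} → j < a + n → Q (R j)) → All Q (run↓ R a n)
  All-run↓ R a zero q = []
  All-run↓ R a (suc n) q = q (subst (a + n <_) (sym (+-suc a n)) ≤-refl) ∷ All-run↓ R a n (λ j< → q (<-trans j< (+-monoʳ-< a ≤-refl)))

  -- When the run is numbered from k, index t carries y = R j.
  InRun↑ : (ℕ → A) → ℕ → ℕ → ℕ → ℕ → A → Set
  InRun↑ R a n k t y = Σ ℕ λ j → y ≡ R j × j + k ≡ a + t × a ≤ j × j < a + n

  InRun↓ : (ℕ → A) → ℕ → ℕ → ℕ → ℕ → A → Set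
  InRun↓ R a n k t y = Σ ℕ λ j → y ≡ R j × suc (j + t) ≡ a + n + k × a ≤ j × j < a + n

  ∈-numbered-run↑ : ∀ R a n k {t y} → (t , y) ∈ numbered k (run↑ R a n) → InRun↑ R a n k t y
  ∈-numbered-run↑ R a (suc n) k (here refl) = a , refl , refl , ≤-refl , m<m+n a (s≤s z≤n)
  ∈-numbered-run↑ R a (suc n) k (there m) with ∈-numbered-run↑ R (suc a) n (suc k) m
  ... | j , eq , pos , lo , hi =
    j , eq , suc-injective (trans (sym (+-suc j k)) pos) , ≤-trans (n≤1+n a) lo , subst (j <_) (sym (+-suc a n)) hi

  ∈-numbered-run↓ : ∀ R a n k {t y} → (t , y) ∈ numbered k (run↓ R a n) → InRun↓ R a n k t y
  ∈-numbered-run↓ R a (suc n) k (here refl) =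
    a + n , refl , shift a n k , m≤m+n a n , subst (a + n <_) (sym (+-suc a n)) ≤-refl
    where shift : ∀ a n k → suc (a + n + k) ≡ a + suc n + k
          shift = solve-∀
  ∈-numbered-run↓ R a (suc n) k (there m) with ∈-numbered-run↓ R a n (suc k) m
  ... | j , eq , pos , lo , hi =
    j , eq , trans pos (shift a n k) , lo , <-trans hi (subst (a + n <_) (sym (+-suc a n)) ≤-refl)
    where shift : ∀ a n k → a + n + suc k ≡ a + suc n + k
          shift = solve-∀

  ∈-numbered-run↑-++ : ∀ R a n k ys {t y} → (t , y) ∈ numbered k (run↑ R a n ++ ys) →
                        InRun↑ R a n k t y ⊎ (t , y) ∈ numbered (k + n) ys
  ∈-numbered-run↑-++ R a n k ys m with ∈-numbered-++⁻ k (run↑ R a n) ys m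
  ... | inj₁ m′ = inj₁ (∈-numbered-run↑ R a n k m′)
  ... | inj₂ m′ = inj₂ (subst (λ z → _ ∈ numbered (k + z) ys) (length-run↑ R a n) m′)

  ∈-numbered-run↓-++ : ∀ R a n k ys {t y} → (t , y) ∈ numbered k (run↓ R a n ++ ys) →
                        InRun↓ R a n k t y ⊎ (t , y) ∈ numbered (k + n) ys
  ∈-numbered-run↓-++ R a n k ys m with ∈-numbered-++⁻ k (run↓ R a n) ys m
  ... | inj₁ m′ = inj₁ (∈-numbered-run↓ R a n k m′)
  ... | inj₂ m′ = inj₂ (subst (λ z → _ ∈ numbered (k + z) ys) (length-run↓ R a n) m′)

-- Circuits in the abstract theta graph

-- The abstract theta graph: branch vertices U and W joined by an edge and by paths
-- whose j-th internal vertices are P j, X j and Y j.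
data Node : Set where
  U W : Node
  P X Y : ℕ → Node

pathWalk : (ℕ → Node) → ℕ → List Node
pathWalk R k = U ∷ run↑ R 0 k ++ [ W ]

thetaEdges : ℕ → ℕ → ℕ → List (Node × Node)
thetaEdges kP kX kY = pairs (U ∷ [ W ]) ++ pairs (pathWalk P kP) ++ pairs (pathWalk X kX) ++ pairs (pathWalk Y kY)

-- Quantifying over every symmetric key compares edge lists as multisets of unordered
-- edges, and specialises both to the labelling into Γ and to a length count.
Traverses : Node → List Node → ℕ → ℕ → ℕ → Set₁
Traverses x w kP kX kY = ∀ {B : Set} (κ : Node × Node → B) → (∀ a b → κ (a , b) ≡ κ (b , a)) →
  map κ (pairs (x ∷ w ++ [ x ])) ↭ map κ (thetaEdges kP kX kY)

module SymmetricKey {B : Set} (κ : Node × Node → B) (κ-sym : ∀ a b → κ (a , b) ≡ κ (b , a)) where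

  κ-run↓ : ∀ R a n s e → map κ (pairs (s ∷ run↓ R a n ++ [ e ])) ↭ map κ (pairs (e ∷ run↑ R a n ++ [ s ]))
  κ-run↓ R a n s e = ↭-trans (↭-reflexive (cong (λ l → map κ (pairs (s ∷ l ++ [ e ]))) (run↓≡reverse-run↑ R a n)))
    (↭-trans (↭-reflexive (cong (λ l → map κ (pairs l)) (sym (reversed (run↑ R a n)))))
    (map-pairs-reverse κ κ-sym (e ∷ run↑ R a n ++ [ s ])))
    where reversed : ∀ l → reverse (e ∷ l ++ [ s ]) ≡ s ∷ reverse l ++ [ e ]
          reversed l = trans (unfold-reverse e (l ++ [ s ])) (cong (_++ [ e ]) (reverse-++ l [ s ]))

  κ-closed-legs : ∀ x l ls → legsEnd x (l ∷ ls) ≡ x →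
                   map κ (pairs (x ∷ legsInterior (l ∷ ls) ++ [ x ])) ≡ concat (map (map κ) (legPairs x (l ∷ ls)))
  κ-closed-legs x l ls closed = trans (cong (map κ) (pairs-closed-legs x l ls closed)) (sym (concat-map (legPairs x (l ∷ ls))))

  κUW : List B
  κUW = map κ (pairs (U ∷ [ W ]))

  κWU≡κUW : map κ (pairs (W ∷ [ U ])) ≡ κUW
  κWU≡κUW = cong [_] (κ-sym W U)

  κPath : (ℕ → Node) → ℕ → List B
  κPath R k = map κ (pairs (pathWalk R k))

  κ-thetaEdges : ∀ kP kX kY → map κ (thetaEdges kP kX kY) ≡ κUW ++ κPath P kP ++ κPath X kX ++ κPath Y kY
  κ-thetaEdges kP kX kY =
    trans (map-++ κ (pairs (U ∷ [ W ])) _) (cong (κUW ++_)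
    (trans (map-++ κ (pairs (pathWalk P kP)) _) (cong (κPath P kP ++_)
    (map-++ κ (pairs (pathWalk X kX)) (pairs (pathWalk Y kY))))))

  κLowerP : ℕ → List B
  κLowerP i = map κ (pairs (U ∷ run↑ P 0 i ++ [ P i ]))

  κUpperP : ℕ → ℕ → List B
  κUpperP i h = map κ (pairs (P i ∷ run↑ P (suc i) h ++ [ W ]))

  κ-thetaEdges-split : ∀ i h kX kY →
                       map κ (thetaEdges (i + suc h) kX kY) ≡ κUW ++ (κLowerP i ++ κUpperP i h) ++ κPath X kX ++ κPath Y kY
  κ-thetaEdges-split i h kX kY =
    trans (κ-thetaEdges (i + suc h) kX kY) (cong (λ z → κUW ++ z ++ κPath X kX ++ κPath Y kY) split)
    where
    split : κPath P (i + suc h) ≡ κLowerP i ++ κUpperP i h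
    split = begin
        map κ (pairs (U ∷ run↑ P 0 (i + suc h) ++ [ W ]))
      ≡⟨ cong (λ l → map κ (pairs (U ∷ l ++ [ W ]))) (run↑-split P i h) ⟩
        map κ (pairs (U ∷ (run↑ P 0 i ++ P i ∷ run↑ P (suc i) h) ++ [ W ]))
      ≡⟨ cong (λ l → map κ (pairs (U ∷ l))) (++-assoc (run↑ P 0 i) _ [ W ]) ⟩
        map κ (pairs (U ∷ run↑ P 0 i ++ P i ∷ run↑ P (suc i) h ++ [ W ]))
      ≡⟨ cong (map κ) (pairs-++-∷ (U ∷ run↑ P 0 i) (P i) _) ⟩
        map κ (pairs (U ∷ run↑ P 0 i ++ [ P i ]) ++ pairs (P i ∷ run↑ P (suc i) h ++ [ W ]))
      ≡⟨ map-++ κ (pairs (U ∷ run↑ P 0 i ++ [ P i ])) _ ⟩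
        κLowerP i ++ κUpperP i h
      ∎

Valid : ℕ → ℕ → ℕ → Node → Set
Valid kP kX kY U = ⊤
Valid kP kX kY W = ⊤
Valid kP kX kY (P j) = j < kP
Valid kP kX kY (X j) = j < kX
Valid kP kX kY (Y j) = j < kY

lower-index : ∀ i h {j} → j < i → j < i + suc h
lower-index i h j<i = <-≤-trans j<i (m≤m+n i (suc h))

upper-index : ∀ i h {j} → j < suc i + h → j < i + suc h
upper-index i h {j} = subst (j <_) (sym (+-suc i h))

record ThetaCircuits (x : Node) (kP kX kY : ℕ) : Set₁ where
  field
    w₁ w₂ : List Node
    traverses₁ : Traverses x w₁ kP kX kY
    traverses₂ : Traverses x w₂ kP kX kY
    valid₁ : All (Valid kP kX kY) w₁
    valid₂ : All (Valid kP kX kY) w₂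
    positionwise-distinct : ∀ {p} → p ∈ numbered 0 w₁ → p ∈ numbered 0 w₂ → ⊥

+-double-< : ∀ a {t h k} → t < h → t < k → suc (a + t + t) < a + h + k
+-double-< a {t} {h} {k} t<h t<k = subst₂ _≤_ (shift a t) (sym (+-assoc a h k)) (+-monoʳ-≤ a (+-mono-≤ t<h t<k))
  where shift : ∀ a t → a + (suc t + suc t) ≡ suc (suc (a + t + t))
        shift = solve-∀

-- P has i vertices below P i and h = i + e + 2 above it.
module BelowCentre (i e kX kY : ℕ) (e≤kX+kY : e ≤ kX + kY) where
  h : ℕ
  h = suc (i + suc e)

  w₁ w₂ : List Node
  w₁ = run↑ P (suc i) h ++ W ∷ run↓ X 0 kX ++ U ∷ run↑ Y 0 kY ++ W ∷ U ∷ run↑ P 0 i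
  w₂ = run↓ P 0 i ++ U ∷ W ∷ run↓ X 0 kX ++ U ∷ run↑ Y 0 kY ++ W ∷ run↓ P (suc i) h

  k₂ : ℕ
  k₂ = suc (suc (suc (suc i) + kX) + kY)

  w₂-U : ∀ {t} → (t , U) ∈ numbered 0 w₂ → t ≡ i ⊎ t ≡ suc (suc i) + kX
  w₂-U m with ∈-numbered-run↓-++ P 0 i 0 _ m
  ... | inj₁ (_ , () , _)
  ... | inj₂ (here refl) = inj₁ refl
  ... | inj₂ (there (here ()))
  ... | inj₂ (there (there m′)) with ∈-numbered-run↓-++ X 0 kX _ _ m′
  ... | inj₁ (_ , () , _)
  ... | inj₂ (here refl) = inj₂ refl
  ... | inj₂ (there m″) with ∈-numbered-run↑-++ Y 0 kY _ _ m″
  ... | inj₁ (_ , () , _)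
  ... | inj₂ (here ())
  ... | inj₂ (there m‴) with ∈-numbered-run↓ P (suc i) h _ m‴
  ... | (_ , () , _)

  w₂-W : ∀ {t} → (t , W) ∈ numbered 0 w₂ → t ≡ suc i ⊎ t ≡ suc (suc (suc i) + kX) + kY
  w₂-W m with ∈-numbered-run↓-++ P 0 i 0 _ m
  ... | inj₁ (_ , () , _)
  ... | inj₂ (here ())
  ... | inj₂ (there (here refl)) = inj₁ refl
  ... | inj₂ (there (there m′)) with ∈-numbered-run↓-++ X 0 kX _ _ m′
  ... | inj₁ (_ , () , _)
  ... | inj₂ (here ())
  ... | inj₂ (there m″) with ∈-numbered-run↑-++ Y 0 kY _ _ m″
  ... | inj₁ (_ , () , _)
  ... | inj₂ (here refl) = inj₂ refl
  ... | inj₂ (there m‴) with ∈-numbered-run↓ P (suc i) h _ m‴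
  ... | (_ , () , _)

  w₂-P : ∀ {t j} → (t , P j) ∈ numbered 0 w₂ → (suc (j + t) ≡ i + 0 × j < i) ⊎ (suc (j + t) ≡ suc i + h + k₂ × i < j)
  w₂-P m with ∈-numbered-run↓-++ P 0 i 0 _ m
  ... | inj₁ (_ , refl , pos , _ , j<i) = inj₁ (pos , j<i)
  ... | inj₂ (here ())
  ... | inj₂ (there (here ()))
  ... | inj₂ (there (there m′)) with ∈-numbered-run↓-++ X 0 kX _ _ m′
  ... | inj₁ (_ , () , _)
  ... | inj₂ (here ())
  ... | inj₂ (there m″) with ∈-numbered-run↑-++ Y 0 kY _ _ m″
  ... | inj₁ (_ , () , _)
  ... | inj₂ (here ())
  ... | inj₂ (there m‴) with ∈-numbered-run↓ P (suc i) h _ m‴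
  ... | (_ , refl , pos , i<j , _) = inj₂ (pos , i<j)

  w₂-X : ∀ {t j} → (t , X j) ∈ numbered 0 w₂ → suc (j + t) ≡ kX + suc (suc i)
  w₂-X m with ∈-numbered-run↓-++ P 0 i 0 _ m
  ... | inj₁ (_ , () , _)
  ... | inj₂ (here ())
  ... | inj₂ (there (here ()))
  ... | inj₂ (there (there m′)) with ∈-numbered-run↓-++ X 0 kX _ _ m′
  ... | inj₁ (_ , refl , pos , _) = pos
  ... | inj₂ (here ())
  ... | inj₂ (there m″) with ∈-numbered-run↑-++ Y 0 kY _ _ m″
  ... | inj₁ (_ , () , _)
  ... | inj₂ (here ())
  ... | inj₂ (there m‴) with ∈-numbered-run↓ P (suc i) h _ m‴
  ... | (_ , () , _)

  w₂-Y : ∀ {t j} → (t , Y j) ∈ numbered 0 w₂ → j + suc (suc (suc i) + kX) ≡ t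
  w₂-Y m with ∈-numbered-run↓-++ P 0 i 0 _ m
  ... | inj₁ (_ , () , _)
  ... | inj₂ (here ())
  ... | inj₂ (there (here ()))
  ... | inj₂ (there (there m′)) with ∈-numbered-run↓-++ X 0 kX _ _ m′
  ... | inj₁ (_ , () , _)
  ... | inj₂ (here ())
  ... | inj₂ (there m″) with ∈-numbered-run↑-++ Y 0 kY _ _ m″
  ... | inj₁ (_ , refl , pos , _) = pos
  ... | inj₂ (here ())
  ... | inj₂ (there m‴) with ∈-numbered-run↓ P (suc i) h _ m‴
  ... | (_ , () , _)

  h≢1+i : h ≢ suc i
  h≢1+i eq = m+1+n≢m i (suc-injective eq)

  i<h : i < h
  i<h = s≤s (m≤m+n i (suc e))

  i≤k₁ : i ≤ suc (suc (suc (suc h + kX) + kY))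
  i≤k₁ = subst (i ≤_) (shift i e kX kY) (m≤m+n i (6 + e + kX + kY))
    where shift : ∀ i e kX kY → i + (6 + e + kX + kY) ≡ suc (suc (suc (suc (suc (i + suc e)) + kX) + kY))
          shift = solve-∀

  -- This is where e ≤ kX + kY is needed: w₂ returns to W only after w₁ has left its upper P-run.
  h<last-W₂ : h < suc (suc (suc i) + kX) + kY
  h<last-W₂ = subst₂ _≤_ (shift₁ i e) (shift₂ i kX kY) (+-monoʳ-≤ (3 + i) e≤kX+kY)
    where shift₁ : ∀ i e → 3 + i + e ≡ suc (suc (i + suc e))
          shift₁ = solve-∀
          shift₂ : ∀ i kX kY → 3 + i + (kX + kY) ≡ suc (suc (suc i) + kX) + kY
          shift₂ = solve-∀

  w₁-traverses : Traverses (P i) w₁ (i + suc h) kX kY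
  w₁-traverses {B} κ κ-sym =
    ↭-trans (↭-reflexive (κ-closed-legs (P i) (run↑ P (suc i) h , W)
                            ((run↓ X 0 kX , U) ∷ (run↑ Y 0 kY , W) ∷ ([] , U) ∷ (run↑ P 0 i , P i) ∷ []) refl))
    (↭-trans (++⁺ˡ (κUpperP i h) (++⁺ (κ-run↓ X 0 kX W U) (++⁺ˡ (κPath Y kY) (++⁺ (↭-reflexive κWU≡κUW) ↭-refl))))
    (↭-trans (solve 5 (λ up x y uw low → up ⊕ x ⊕ y ⊕ uw ⊕ low ⊕ id ⊜ uw ⊕ (low ⊕ up) ⊕ x ⊕ y) ↭-refl
                (κUpperP i h) (κPath X kX) (κPath Y kY) κUW (κLowerP i))
    (↭-reflexive (sym (κ-thetaEdges-split i h kX kY)))))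
    where open SymmetricKey κ κ-sym
          open import Algebra.Solver.CommutativeMonoid (++-commutativeMonoid {A = B}) using (solve; _⊜_; _⊕_; id)

  w₂-traverses : Traverses (P i) w₂ (i + suc h) kX kY
  w₂-traverses {B} κ κ-sym =
    ↭-trans (↭-reflexive (κ-closed-legs (P i) (run↓ P 0 i , U)
                            (([] , W) ∷ (run↓ X 0 kX , U) ∷ (run↑ Y 0 kY , W) ∷ (run↓ P (suc i) h , P i) ∷ []) refl))
    (↭-trans (++⁺ (κ-run↓ P 0 i (P i) U) (++⁺ˡ κUW (++⁺ (κ-run↓ X 0 kX W U) (++⁺ˡ (κPath Y kY) (++⁺ (κ-run↓ P (suc i) h W (P i)) ↭-refl)))))
    (↭-trans (solve 5 (λ low uw x y up → low ⊕ uw ⊕ x ⊕ y ⊕ up ⊕ id ⊜ uw ⊕ (low ⊕ up) ⊕ x ⊕ y) ↭-refl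
                (κLowerP i) κUW (κPath X kX) (κPath Y kY) (κUpperP i h))
    (↭-reflexive (sym (κ-thetaEdges-split i h kX kY)))))
    where open SymmetricKey κ κ-sym
          open import Algebra.Solver.CommutativeMonoid (++-commutativeMonoid {A = B}) using (solve; _⊜_; _⊕_; id)

  positionwise-distinct : ∀ {t y} → (t , y) ∈ numbered 0 w₁ → (t , y) ∈ numbered 0 w₂ → ⊥
  positionwise-distinct m₁ m₂ with ∈-numbered-run↑-++ P (suc i) h 0 _ m₁
  positionwise-distinct m₁ m₂ | inj₁ (j , refl , pos₁ , i<j , j<1+i+h) with w₂-P m₂
  ... | inj₁ (_ , j<i) = <-asym i<j j<i
  ... | inj₂ (pos₂ , _) = <⇒≢ (+-double-< (suc i) t<h (<-trans t<h (<-trans h<last-W₂ (n<1+n _))))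
                               (trans (cong (λ z → suc (z + _)) (sym j≡1+i+t)) pos₂)
    where
    j≡1+i+t : j ≡ suc i + _
    j≡1+i+t = trans (sym (+-identityʳ j)) pos₁
    t<h : _ < h
    t<h = +-cancelˡ-< (suc i) _ _ (subst (_< suc i + h) j≡1+i+t j<1+i+h)
  positionwise-distinct m₁ m₂ | inj₂ (here refl) with w₂-W m₂
  ... | inj₁ eq = h≢1+i eq
  ... | inj₂ eq = <⇒≢ h<last-W₂ eq
  positionwise-distinct m₁ m₂ | inj₂ (there m′) with ∈-numbered-run↓-++ X 0 kX (suc h) _ m′
  ... | inj₁ (j , refl , pos₁ , _) = h≢1+i (suc-injective (+-cancelˡ-≡ kX _ _ (trans (sym pos₁) (w₂-X m₂))))
  ... | inj₂ (here refl) with w₂-U m₂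
  ...   | inj₁ eq = >⇒≢ (≤-trans i<h (≤-trans (n≤1+n h) (m≤m+n (suc h) kX))) eq
  ...   | inj₂ eq = h≢1+i (suc-injective (+-cancelʳ-≡ kX _ _ eq))
  positionwise-distinct m₁ m₂ | inj₂ (there m′) | inj₂ (there m″) with ∈-numbered-run↑-++ Y 0 kY (suc (suc h + kX)) _ m″
  ... | inj₁ (j , refl , pos₁ , _) =
    h≢1+i (+-cancelʳ-≡ kX _ _ (suc-injective (suc-injective (+-cancelˡ-≡ j _ _ (trans pos₁ (sym (w₂-Y m₂)))))))
  ... | inj₂ (here refl) with w₂-W m₂
  ...   | inj₁ eq = >⇒≢ (s≤s (m≤n⇒m≤n+o kY (≤-trans i<h (≤-trans (n≤1+n h) (m≤m+n (suc h) kX))))) eq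
  ...   | inj₂ eq = h≢1+i (+-cancelʳ-≡ kX _ _ (suc-injective (suc-injective (+-cancelʳ-≡ kY _ _ eq))))
  positionwise-distinct m₁ m₂ | inj₂ (there m′) | inj₂ (there m″) | inj₂ (there (here refl)) with w₂-U m₂
  ...   | inj₁ eq = >⇒≢ (s≤s (m≤n⇒m≤n+o kY (≤-trans (<⇒≤ i<h) (≤-trans (n≤1+n h) (≤-trans (m≤m+n (suc h) kX) (n≤1+n _)))))) eq
  ...   | inj₂ eq = >⇒≢ (s≤s (m≤n⇒m≤n+o kY (≤-trans (+-monoˡ-≤ kX (s≤s i<h)) (n≤1+n _)))) eq
  positionwise-distinct m₁ m₂ | inj₂ (there m′) | inj₂ (there m″) | inj₂ (there (there m‴)) with ∈-numbered-run↑ P 0 i _ m‴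
  ... | (j , refl , pos₁ , _ , j<i) with w₂-P m₂
  ...   | inj₁ (pos₂ , _) = >⇒≢ (s≤s (≤-trans (≤-trans i≤k₁ (≤-trans (m≤n+m _ j) (≤-reflexive pos₁))) (m≤n+m _ j)))
                                 (trans pos₂ (+-identityʳ i))
  ...   | inj₂ (_ , i<j) = <-asym i<j j<i

  valid₁ : All (Valid (i + suc h) kX kY) w₁
  valid₁ = All.++⁺ (All-run↑ P (suc i) h (upper-index i h)) (tt ∷ All.++⁺ (All-run↓ X 0 kX (λ j< → j<))
             (tt ∷ All.++⁺ (All-run↑ Y 0 kY (λ j< → j<)) (tt ∷ tt ∷ All-run↑ P 0 i (lower-index i h))))

  valid₂ : All (Valid (i + suc h) kX kY) w₂
  valid₂ = All.++⁺ (All-run↓ P 0 i (lower-index i h)) (tt ∷ tt ∷ All.++⁺ (All-run↓ X 0 kX (λ j< → j<))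
             (tt ∷ All.++⁺ (All-run↑ Y 0 kY (λ j< → j<)) (tt ∷ All-run↓ P (suc i) h (upper-index i h))))

  circuits : ThetaCircuits (P i) (i + suc h) kX kY
  circuits = record { w₁ = w₁ ; w₂ = w₂ ; traverses₁ = w₁-traverses ; traverses₂ = w₂-traverses
                    ; valid₁ = valid₁ ; valid₂ = valid₂ ; positionwise-distinct = positionwise-distinct }

-- P has i vertices below P i and h = i + 1 above it.
module AtCentre (i kX kY : ℕ) (1≤kX : 1 ≤ kX) (1≤kY : 1 ≤ kY) where
  h : ℕ
  h = suc i

  w₁ w₂ : List Node
  w₁ = run↑ P (suc i) h ++ W ∷ U ∷ run↑ X 0 kX ++ W ∷ run↓ Y 0 kY ++ U ∷ run↑ P 0 i
  w₂ = run↓ P 0 i ++ U ∷ run↑ X 0 kX ++ W ∷ run↓ Y 0 kY ++ U ∷ W ∷ run↓ P (suc i) h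

  k₂ : ℕ
  k₂ = suc (suc (suc (suc i + kX) + kY))

  w₂-U : ∀ {t} → (t , U) ∈ numbered 0 w₂ → t ≡ i ⊎ t ≡ suc (suc i + kX) + kY
  w₂-U m with ∈-numbered-run↓-++ P 0 i 0 _ m
  ... | inj₁ (_ , () , _)
  ... | inj₂ (here refl) = inj₁ refl
  ... | inj₂ (there m′) with ∈-numbered-run↑-++ X 0 kX _ _ m′
  ... | inj₁ (_ , () , _)
  ... | inj₂ (here ())
  ... | inj₂ (there m″) with ∈-numbered-run↓-++ Y 0 kY _ _ m″
  ... | inj₁ (_ , () , _)
  ... | inj₂ (here refl) = inj₂ refl
  ... | inj₂ (there (here ()))
  ... | inj₂ (there (there m‴)) with ∈-numbered-run↓ P (suc i) h _ m‴
  ... | (_ , () , _)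

  w₂-W : ∀ {t} → (t , W) ∈ numbered 0 w₂ → t ≡ suc i + kX ⊎ t ≡ suc (suc (suc i + kX) + kY)
  w₂-W m with ∈-numbered-run↓-++ P 0 i 0 _ m
  ... | inj₁ (_ , () , _)
  ... | inj₂ (here ())
  ... | inj₂ (there m′) with ∈-numbered-run↑-++ X 0 kX _ _ m′
  ... | inj₁ (_ , () , _)
  ... | inj₂ (here refl) = inj₁ refl
  ... | inj₂ (there m″) with ∈-numbered-run↓-++ Y 0 kY _ _ m″
  ... | inj₁ (_ , () , _)
  ... | inj₂ (here ())
  ... | inj₂ (there (here refl)) = inj₂ refl
  ... | inj₂ (there (there m‴)) with ∈-numbered-run↓ P (suc i) h _ m‴
  ... | (_ , () , _)

  w₂-P : ∀ {t j} → (t , P j) ∈ numbered 0 w₂ → (suc (j + t) ≡ i + 0 × j < i) ⊎ (suc (j + t) ≡ suc i + h + k₂ × i < j)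
  w₂-P m with ∈-numbered-run↓-++ P 0 i 0 _ m
  ... | inj₁ (_ , refl , pos , _ , j<i) = inj₁ (pos , j<i)
  ... | inj₂ (here ())
  ... | inj₂ (there m′) with ∈-numbered-run↑-++ X 0 kX _ _ m′
  ... | inj₁ (_ , () , _)
  ... | inj₂ (here ())
  ... | inj₂ (there m″) with ∈-numbered-run↓-++ Y 0 kY _ _ m″
  ... | inj₁ (_ , () , _)
  ... | inj₂ (here ())
  ... | inj₂ (there (here ()))
  ... | inj₂ (there (there m‴)) with ∈-numbered-run↓ P (suc i) h _ m‴
  ... | (_ , refl , pos , i<j , _) = inj₂ (pos , i<j)

  w₂-X : ∀ {t j} → (t , X j) ∈ numbered 0 w₂ → j + suc i ≡ t
  w₂-X m with ∈-numbered-run↓-++ P 0 i 0 _ m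
  ... | inj₁ (_ , () , _)
  ... | inj₂ (here ())
  ... | inj₂ (there m′) with ∈-numbered-run↑-++ X 0 kX _ _ m′
  ... | inj₁ (_ , refl , pos , _) = pos
  ... | inj₂ (here ())
  ... | inj₂ (there m″) with ∈-numbered-run↓-++ Y 0 kY _ _ m″
  ... | inj₁ (_ , () , _)
  ... | inj₂ (here ())
  ... | inj₂ (there (here ()))
  ... | inj₂ (there (there m‴)) with ∈-numbered-run↓ P (suc i) h _ m‴
  ... | (_ , () , _)

  w₂-Y : ∀ {t j} → (t , Y j) ∈ numbered 0 w₂ → suc (j + t) ≡ kY + suc (suc i + kX)
  w₂-Y m with ∈-numbered-run↓-++ P 0 i 0 _ m
  ... | inj₁ (_ , () , _)
  ... | inj₂ (here ())
  ... | inj₂ (there m′) with ∈-numbered-run↑-++ X 0 kX _ _ m′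
  ... | inj₁ (_ , () , _)
  ... | inj₂ (here ())
  ... | inj₂ (there m″) with ∈-numbered-run↓-++ Y 0 kY _ _ m″
  ... | inj₁ (_ , refl , pos , _) = pos
  ... | inj₂ (here ())
  ... | inj₂ (there (here ()))
  ... | inj₂ (there (there m‴)) with ∈-numbered-run↓ P (suc i) h _ m‴
  ... | (_ , () , _)

  h<k₂ : h < k₂
  h<k₂ = s≤s (s≤s (≤-trans (n≤1+n i) (≤-trans (m≤m+n (suc i) kX) (≤-trans (n≤1+n _) (m≤m+n _ kY)))))

  ≢+kX : ∀ {a} → a ≢ a + kX
  ≢+kX {a} = <⇒≢ (m<m+n a 1≤kX)

  ≢+kY : ∀ {a} → a ≢ a + kY
  ≢+kY {a} = <⇒≢ (m<m+n a 1≤kY)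

  2+h≢h : suc (suc h) ≢ h
  2+h≢h = >⇒≢ (s≤s (n≤1+n h))

  i≤k₁ : i ≤ suc (suc (suc (suc h) + kX) + kY)
  i≤k₁ = subst (i ≤_) (shift i kX kY) (m≤m+n i (5 + kX + kY))
    where shift : ∀ i kX kY → i + (5 + kX + kY) ≡ suc (suc (suc (suc (suc i)) + kX) + kY)
          shift = solve-∀

  w₁-traverses : Traverses (P i) w₁ (i + suc h) kX kY
  w₁-traverses {B} κ κ-sym =
    ↭-trans (↭-reflexive (κ-closed-legs (P i) (run↑ P (suc i) h , W)
                            (([] , U) ∷ (run↑ X 0 kX , W) ∷ (run↓ Y 0 kY , U) ∷ (run↑ P 0 i , P i) ∷ []) refl))
    (↭-trans (++⁺ˡ (κUpperP i h) (++⁺ (↭-reflexive κWU≡κUW) (++⁺ˡ (κPath X kX) (++⁺ (κ-run↓ Y 0 kY W U) ↭-refl))))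
    (↭-trans (solve 5 (λ up uw x y low → up ⊕ uw ⊕ x ⊕ y ⊕ low ⊕ id ⊜ uw ⊕ (low ⊕ up) ⊕ x ⊕ y) ↭-refl
                (κUpperP i h) κUW (κPath X kX) (κPath Y kY) (κLowerP i))
    (↭-reflexive (sym (κ-thetaEdges-split i h kX kY)))))
    where open SymmetricKey κ κ-sym
          open import Algebra.Solver.CommutativeMonoid (++-commutativeMonoid {A = B}) using (solve; _⊜_; _⊕_; id)

  w₂-traverses : Traverses (P i) w₂ (i + suc h) kX kY
  w₂-traverses {B} κ κ-sym =
    ↭-trans (↭-reflexive (κ-closed-legs (P i) (run↓ P 0 i , U)
                            ((run↑ X 0 kX , W) ∷ (run↓ Y 0 kY , U) ∷ ([] , W) ∷ (run↓ P (suc i) h , P i) ∷ []) refl))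
    (↭-trans (++⁺ (κ-run↓ P 0 i (P i) U) (++⁺ˡ (κPath X kX) (++⁺ (κ-run↓ Y 0 kY W U) (++⁺ˡ κUW (++⁺ (κ-run↓ P (suc i) h W (P i)) ↭-refl)))))
    (↭-trans (solve 5 (λ low x y uw up → low ⊕ x ⊕ y ⊕ uw ⊕ up ⊕ id ⊜ uw ⊕ (low ⊕ up) ⊕ x ⊕ y) ↭-refl
                (κLowerP i) (κPath X kX) (κPath Y kY) κUW (κUpperP i h))
    (↭-reflexive (sym (κ-thetaEdges-split i h kX kY)))))
    where open SymmetricKey κ κ-sym
          open import Algebra.Solver.CommutativeMonoid (++-commutativeMonoid {A = B}) using (solve; _⊜_; _⊕_; id)

  positionwise-distinct : ∀ {t y} → (t , y) ∈ numbered 0 w₁ → (t , y) ∈ numbered 0 w₂ → ⊥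
  positionwise-distinct m₁ m₂ with ∈-numbered-run↑-++ P (suc i) h 0 _ m₁
  positionwise-distinct m₁ m₂ | inj₁ (j , refl , pos₁ , i<j , j<1+i+h) with w₂-P m₂
  ... | inj₁ (_ , j<i) = <-asym i<j j<i
  ... | inj₂ (pos₂ , _) = <⇒≢ (+-double-< (suc i) t<h (<-trans t<h h<k₂)) (trans (cong (λ z → suc (z + _)) (sym j≡1+i+t)) pos₂)
    where
    j≡1+i+t : j ≡ suc i + _
    j≡1+i+t = trans (sym (+-identityʳ j)) pos₁
    t<h : _ < h
    t<h = +-cancelˡ-< (suc i) _ _ (subst (_< suc i + h) j≡1+i+t j<1+i+h)
  positionwise-distinct m₁ m₂ | inj₂ (here refl) with w₂-W m₂
  ... | inj₁ eq = ≢+kX eq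
  ... | inj₂ eq = <⇒≢ (s≤s (s≤s (≤-trans (n≤1+n i) (≤-trans (m≤m+n (suc i) kX) (m≤m+n _ kY))))) eq
  positionwise-distinct m₁ m₂ | inj₂ (there (here refl)) with w₂-U m₂
  ... | inj₁ eq = >⇒≢ (s≤s (n≤1+n i)) eq
  ... | inj₂ eq = <⇒≢ (s≤s (≤-trans (m<m+n (suc i) 1≤kX) (m≤m+n _ kY))) eq
  positionwise-distinct m₁ m₂ | inj₂ (there (there m′)) with ∈-numbered-run↑-++ X 0 kX (suc (suc h)) _ m′
  ... | inj₁ (j , refl , pos₁ , _) = 2+h≢h (+-cancelˡ-≡ j _ _ (trans pos₁ (sym (w₂-X m₂))))
  ... | inj₂ (here refl) with w₂-W m₂
  ...   | inj₁ eq = 2+h≢h (+-cancelʳ-≡ kX _ _ eq)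
  ...   | inj₂ eq = ≢+kY (suc-injective (suc-injective (suc-injective eq)))
  positionwise-distinct m₁ m₂ | inj₂ (there (there m′)) | inj₂ (there m″) with ∈-numbered-run↓-++ Y 0 kY (suc (suc (suc h) + kX)) _ m″
  ... | inj₁ (j , refl , pos₁ , _) = 2+h≢h (+-cancelʳ-≡ kX _ _ (suc-injective (+-cancelˡ-≡ kY _ _ (trans (sym pos₁) (w₂-Y m₂)))))
  ... | inj₂ (here refl) with w₂-U m₂
  ...   | inj₁ eq = >⇒≢ (s≤s (≤-trans (n≤1+n i) (≤-trans (n≤1+n _) (≤-trans (n≤1+n _) (≤-trans (m≤m+n _ kX) (m≤m+n _ kY)))))) eq
  ...   | inj₂ eq = 2+h≢h (+-cancelʳ-≡ kX _ _ (suc-injective (+-cancelʳ-≡ kY _ _ eq)))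
  positionwise-distinct m₁ m₂ | inj₂ (there (there m′)) | inj₂ (there m″) | inj₂ (there m‴) with ∈-numbered-run↑ P 0 i _ m‴
  ... | (j , refl , pos₁ , _ , j<i) with w₂-P m₂
  ...   | inj₁ (pos₂ , _) = >⇒≢ (s≤s (≤-trans (≤-trans i≤k₁ (≤-trans (m≤n+m _ j) (≤-reflexive pos₁))) (m≤n+m _ j)))
                                 (trans pos₂ (+-identityʳ i))
  ...   | inj₂ (_ , i<j) = <-asym i<j j<i

  valid₁ : All (Valid (i + suc h) kX kY) w₁
  valid₁ = All.++⁺ (All-run↑ P (suc i) h (upper-index i h)) (tt ∷ tt ∷ All.++⁺ (All-run↑ X 0 kX (λ j< → j<))
             (tt ∷ All.++⁺ (All-run↓ Y 0 kY (λ j< → j<)) (tt ∷ All-run↑ P 0 i (lower-index i h))))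

  valid₂ : All (Valid (i + suc h) kX kY) w₂
  valid₂ = All.++⁺ (All-run↓ P 0 i (lower-index i h)) (tt ∷ All.++⁺ (All-run↑ X 0 kX (λ j< → j<))
             (tt ∷ All.++⁺ (All-run↓ Y 0 kY (λ j< → j<)) (tt ∷ tt ∷ All-run↓ P (suc i) h (upper-index i h))))

  circuits : ThetaCircuits (P i) (i + suc h) kX kY
  circuits = record { w₁ = w₁ ; w₂ = w₂ ; traverses₁ = w₁-traverses ; traverses₂ = w₂-traverses
                    ; valid₁ = valid₁ ; valid₂ = valid₂ ; positionwise-distinct = positionwise-distinct }

module AtBranch (kP kX kY : ℕ) (kP≤kX : kP ≤ kX) (1≤kX : 1 ≤ kX) (1≤kY : 1 ≤ kY) where
  w₁ w₂ : List Node
  w₁ = W ∷ run↓ P 0 kP ++ U ∷ run↑ X 0 kX ++ W ∷ run↓ Y 0 kY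
  w₂ = run↑ X 0 kX ++ W ∷ run↓ Y 0 kY ++ U ∷ run↑ P 0 kP ++ [ W ]

  w₂-W : ∀ {t} → (t , W) ∈ numbered 0 w₂ → t ≡ kX ⊎ t ≡ suc (suc kX + kY) + kP
  w₂-W m with ∈-numbered-run↑-++ X 0 kX 0 _ m
  ... | inj₁ (_ , () , _)
  ... | inj₂ (here refl) = inj₁ refl
  ... | inj₂ (there m′) with ∈-numbered-run↓-++ Y 0 kY _ _ m′
  ... | inj₁ (_ , () , _)
  ... | inj₂ (here ())
  ... | inj₂ (there m″) with ∈-numbered-run↑-++ P 0 kP _ _ m″
  ... | inj₁ (_ , () , _)
  ... | inj₂ (here refl) = inj₂ refl

  w₂-U : ∀ {t} → (t , U) ∈ numbered 0 w₂ → t ≡ suc kX + kY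
  w₂-U m with ∈-numbered-run↑-++ X 0 kX 0 _ m
  ... | inj₁ (_ , () , _)
  ... | inj₂ (here ())
  ... | inj₂ (there m′) with ∈-numbered-run↓-++ Y 0 kY _ _ m′
  ... | inj₁ (_ , () , _)
  ... | inj₂ (here refl) = refl
  ... | inj₂ (there m″) with ∈-numbered-run↑-++ P 0 kP _ _ m″
  ... | inj₁ (_ , () , _)
  ... | inj₂ (here ())

  w₂-P : ∀ {t j} → (t , P j) ∈ numbered 0 w₂ → j + suc (suc kX + kY) ≡ t
  w₂-P m with ∈-numbered-run↑-++ X 0 kX 0 _ m
  ... | inj₁ (_ , () , _)
  ... | inj₂ (here ())
  ... | inj₂ (there m′) with ∈-numbered-run↓-++ Y 0 kY _ _ m′
  ... | inj₁ (_ , () , _)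
  ... | inj₂ (here ())
  ... | inj₂ (there m″) with ∈-numbered-run↑-++ P 0 kP _ _ m″
  ... | inj₁ (_ , refl , pos , _) = pos
  ... | inj₂ (here ())

  w₂-X : ∀ {t j} → (t , X j) ∈ numbered 0 w₂ → j + 0 ≡ t
  w₂-X m with ∈-numbered-run↑-++ X 0 kX 0 _ m
  ... | inj₁ (_ , refl , pos , _) = pos
  ... | inj₂ (here ())
  ... | inj₂ (there m′) with ∈-numbered-run↓-++ Y 0 kY _ _ m′
  ... | inj₁ (_ , () , _)
  ... | inj₂ (here ())
  ... | inj₂ (there m″) with ∈-numbered-run↑-++ P 0 kP _ _ m″
  ... | inj₁ (_ , () , _)
  ... | inj₂ (here ())

  w₂-Y : ∀ {t j} → (t , Y j) ∈ numbered 0 w₂ → suc (j + t) ≡ kY + suc kX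
  w₂-Y m with ∈-numbered-run↑-++ X 0 kX 0 _ m
  ... | inj₁ (_ , () , _)
  ... | inj₂ (here ())
  ... | inj₂ (there m′) with ∈-numbered-run↓-++ Y 0 kY _ _ m′
  ... | inj₁ (_ , refl , pos , _) = pos
  ... | inj₂ (here ())
  ... | inj₂ (there m″) with ∈-numbered-run↑-++ P 0 kP _ _ m″
  ... | inj₁ (_ , () , _)
  ... | inj₂ (here ())

  w₁-traverses : Traverses U w₁ kP kX kY
  w₁-traverses {B} κ κ-sym =
    ↭-trans (↭-reflexive (κ-closed-legs U ([] , W)
                            ((run↓ P 0 kP , U) ∷ (run↑ X 0 kX , W) ∷ (run↓ Y 0 kY , U) ∷ []) refl))
    (↭-trans (++⁺ˡ κUW (++⁺ (κ-run↓ P 0 kP W U) (++⁺ˡ (κPath X kX) (++⁺ (κ-run↓ Y 0 kY W U) ↭-refl))))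
    (↭-trans (solve 4 (λ uw p x y → uw ⊕ p ⊕ x ⊕ y ⊕ id ⊜ uw ⊕ p ⊕ x ⊕ y) ↭-refl κUW (κPath P kP) (κPath X kX) (κPath Y kY))
    (↭-reflexive (sym (κ-thetaEdges kP kX kY)))))
    where open SymmetricKey κ κ-sym
          open import Algebra.Solver.CommutativeMonoid (++-commutativeMonoid {A = B}) using (solve; _⊜_; _⊕_; id)

  w₂-traverses : Traverses U w₂ kP kX kY
  w₂-traverses {B} κ κ-sym =
    ↭-trans (↭-reflexive (κ-closed-legs U (run↑ X 0 kX , W)
                            ((run↓ Y 0 kY , U) ∷ (run↑ P 0 kP , W) ∷ ([] , U) ∷ []) refl))
    (↭-trans (++⁺ˡ (κPath X kX) (++⁺ (κ-run↓ Y 0 kY W U) (++⁺ˡ (κPath P kP) (++⁺ (↭-reflexive κWU≡κUW) ↭-refl))))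
    (↭-trans (solve 4 (λ x y p uw → x ⊕ y ⊕ p ⊕ uw ⊕ id ⊜ uw ⊕ p ⊕ x ⊕ y) ↭-refl (κPath X kX) (κPath Y kY) (κPath P kP) κUW)
    (↭-reflexive (sym (κ-thetaEdges kP kX kY)))))
    where open SymmetricKey κ κ-sym
          open import Algebra.Solver.CommutativeMonoid (++-commutativeMonoid {A = B}) using (solve; _⊜_; _⊕_; id)

  positionwise-distinct : ∀ {t y} → (t , y) ∈ numbered 0 w₁ → (t , y) ∈ numbered 0 w₂ → ⊥
  positionwise-distinct (here refl) m₂ with w₂-W m₂
  ... | inj₁ eq = <⇒≢ 1≤kX eq
  ... | inj₂ ()
  positionwise-distinct (there m₁) m₂ with ∈-numbered-run↓-++ P 0 kP 1 _ m₁
  ... | inj₁ (j , refl , pos₁ , _) = >⇒≢ P-positions-apart (trans (cong (λ z → suc (j + z)) (w₂-P m₂)) pos₁)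
    where
    P-positions-apart : kP + 1 < suc (j + (j + suc (suc kX + kY)))
    P-positions-apart = s≤s (subst (_≤ j + (j + suc (suc kX + kY))) (+-comm 1 kP)
            (≤-trans (s≤s (≤-trans kP≤kX (≤-trans (n≤1+n kX) (m≤m+n (suc kX) kY)))) (≤-trans (m≤n+m _ j) (m≤n+m _ j))))
  ... | inj₂ (here refl) = <⇒≢ {suc kP} {suc kX + kY} (s≤s (≤-trans (s≤s kP≤kX) (m<m+n kX 1≤kY))) (w₂-U m₂)
  ... | inj₂ (there m′) with ∈-numbered-run↑-++ X 0 kX (suc (suc kP)) _ m′
  ...   | inj₁ (j , refl , pos₁ , _) = 1+n≢0 (+-cancelˡ-≡ j _ _ (trans pos₁ (sym (w₂-X m₂))))
  ...   | inj₂ (here refl) with w₂-W m₂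
  ...     | inj₁ eq = >⇒≢ (s≤s (m≤n+m kX (suc kP))) eq
  ...     | inj₂ eq = <⇒≢ (m<m+n (kP + kX) 1≤kY) (trans (suc-injective (suc-injective eq)) (reorder kP kX kY))
    where reorder : ∀ kP kX kY → kX + kY + kP ≡ kP + kX + kY
          reorder = solve-∀
  positionwise-distinct (there m₁) m₂ | inj₂ (there m′) | inj₂ (there m″) with ∈-numbered-run↓ Y 0 kY _ m″
  ... | (j , refl , pos₁ , _) = >⇒≢ (s≤s (m≤n+m kX (suc kP))) (suc-injective (+-cancelˡ-≡ kY _ _ (trans (sym pos₁) (w₂-Y m₂))))

  valid₁ : All (Valid kP kX kY) w₁
  valid₁ = tt ∷ All.++⁺ (All-run↓ P 0 kP (λ j< → j<))
                  (tt ∷ All.++⁺ (All-run↑ X 0 kX (λ j< → j<)) (tt ∷ All-run↓ Y 0 kY (λ j< → j<)))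

  valid₂ : All (Valid kP kX kY) w₂
  valid₂ = All.++⁺ (All-run↑ X 0 kX (λ j< → j<))
             (tt ∷ All.++⁺ (All-run↓ Y 0 kY (λ j< → j<)) (tt ∷ All.++⁺ (All-run↑ P 0 kP (λ j< → j<)) (tt ∷ [])))

  circuits : ThetaCircuits U kP kX kY
  circuits = record { w₁ = w₁ ; w₂ = w₂ ; traverses₁ = w₁-traverses ; traverses₂ = w₂-traverses
                    ; valid₁ = valid₁ ; valid₂ = valid₂ ; positionwise-distinct = positionwise-distinct }

-- Eulerian circuits and proper 2-colourings

norm-comm : ∀ a b → norm (a , b) ≡ norm (b , a)
norm-comm a b = cong₂ _,_ (⊓-comm a b) (⊔-comm a b)

norm≡id⊎swap : ∀ a b → norm (a , b) ≡ (a , b) ⊎ norm (a , b) ≡ (b , a)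
norm≡id⊎swap a b with ≤-total a b
... | inj₁ a≤b = inj₁ (cong₂ _,_ (m≤n⇒m⊓n≡m a≤b) (m≤n⇒m⊔n≡n a≤b))
... | inj₂ b≤a = inj₂ (cong₂ _,_ (m≥n⇒m⊓n≡n b≤a) (m≥n⇒m⊔n≡m b≤a))

norm-injective : ∀ {a b c d} → norm (a , b) ≡ norm (c , d) → (a , b) ≡ (c , d) ⊎ (a , b) ≡ (d , c)
norm-injective {a} {b} {c} {d} eq with norm≡id⊎swap a b | norm≡id⊎swap c d
... | inj₁ p | inj₁ q = inj₁ (trans (sym p) (trans eq q))
... | inj₁ p | inj₂ q = inj₂ (trans (sym p) (trans eq q))
... | inj₂ p | inj₁ q = inj₂ (cong swap (trans (sym p) (trans eq q)))
... | inj₂ p | inj₂ q = inj₁ (cong swap (trans (sym p) (trans eq q)))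

length-steps : ∀ a l → length (steps (a ∷ l)) ≡ length l
length-steps a l = trans (cong length (steps≡pairs (a ∷ l))) (length-pairs a l)

ProperColouring : Graph → (ℕ → Bool) → Set
ProperColouring G col = All (λ e → col (proj₁ e) ≢ col (proj₂ e)) (edges G)

module _ (G : Graph) where

  length-circuit : ∀ {x ws} → EulerCircuit G x ws → suc (length ws) ≡ length (edges G)
  length-circuit {x} {ws} euler = begin
    suc (length ws)                              ≡⟨ +-comm 1 (length ws) ⟩
    length ws + 1                                ≡⟨ length-++ ws ⟨
    length (ws ++ [ x ])                         ≡⟨ length-steps x (ws ++ [ x ]) ⟨
    length (steps (x ∷ ws ++ [ x ]))             ≡⟨ length-map norm (steps (x ∷ ws ++ [ x ])) ⟨
    length (map norm (steps (x ∷ ws ++ [ x ])))  ≡⟨ ↭-length euler ⟩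
    length (map norm (edges G))                  ≡⟨ length-map norm (edges G) ⟩
    length (edges G)                             ∎

  Walk : List ℕ → Set
  Walk l = ∀ {a b} → (a , b) ∈ steps l → Adj G a b

  circuit-walk : ∀ {x ws} → EulerCircuit G x ws → Walk (x ∷ ws ++ [ x ])
  circuit-walk euler m with ∈-map⁻ norm (∈-resp-↭ euler (∈-map⁺ norm m))
  ... | _ , edge , eq with norm-injective eq
  ... | inj₁ refl = inj₁ edge
  ... | inj₂ refl = inj₂ edge

  proper-adjacent : ∀ {col} → ProperColouring G col → ∀ {a b} → Adj G a b → col a ≢ col b
  proper-adjacent proper (inj₁ edge) = lookup proper edge
  proper-adjacent proper (inj₂ edge) eq = lookup proper edge (sym eq)

  walks-colours-agree : ∀ {col} → ProperColouring G col → ∀ {a b} xs ys → col a ≡ col b →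
                        Walk (a ∷ xs) → Walk (b ∷ ys) → length xs ≡ length ys →
                        Pointwise (λ p q → col p ≡ col q) xs ys
  walks-colours-agree proper [] [] _ _ _ _ = []
  walks-colours-agree {col} proper {a} {b} (x ∷ xs) (y ∷ ys) a~b walk₁ walk₂ eq = x~y
    ∷ walks-colours-agree proper xs ys x~y (λ m → walk₁ (there m)) (λ m → walk₂ (there m)) (suc-injective eq)
    where
    x~y : col x ≡ col y
    x~y = begin
      col x        ≡⟨ ¬-not (≢-sym (proper-adjacent proper (walk₁ (here refl)))) ⟩
      not (col a)  ≡⟨ cong not a~b ⟩
      not (col b)  ≡⟨ ¬-not (≢-sym (proper-adjacent proper (walk₂ (here refl)))) ⟨
      col y        ∎

  circuits-colours-agree : ∀ {col} → ProperColouring G col → ∀ {x ws₁ ws₂} →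
                           EulerCircuit G x ws₁ → EulerCircuit G x ws₂ → Pointwise (λ p q → col p ≡ col q) ws₁ ws₂
  circuits-colours-agree proper {x} {ws₁} {ws₂} euler₁ euler₂ =
    ++-cancelʳ ws₁ ws₂ (walks-colours-agree proper (ws₁ ++ [ x ]) (ws₂ ++ [ x ]) refl
      (circuit-walk euler₁) (circuit-walk euler₂) same-length)
    where
    same-length : length (ws₁ ++ [ x ]) ≡ length (ws₂ ++ [ x ])
    same-length = begin
      length (ws₁ ++ [ x ])  ≡⟨ trans (length-++ ws₁) (+-comm (length ws₁) 1) ⟩
      suc (length ws₁)       ≡⟨ trans (length-circuit euler₁) (sym (length-circuit euler₂)) ⟩
      suc (length ws₂)       ≡⟨ trans (+-comm 1 (length ws₂)) (sym (length-++ ws₂)) ⟩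
      length (ws₂ ++ [ x ])  ∎

  avoiding-if-distinct : ∀ {col} → ProperColouring G col → ∀ {xs ys} → Pointwise _≢_ xs ys →
                         Pointwise (λ p q → col p ≡ col q) xs ys → Avoiding G xs ys
  avoiding-if-distinct proper [] [] = []
  avoiding-if-distinct proper (x≢y ∷ ds) (x~y ∷ cs) = (x≢y , λ adj → proper-adjacent proper adj x~y) ∷ avoiding-if-distinct proper ds cs

pathEdges≡pairs : ∀ s k → pathEdges s k ≡ pairs (0 ∷ range s k ++ [ 1 ])
pathEdges≡pairs s zero = refl
pathEdges≡pairs s (suc zero) = refl
pathEdges≡pairs s (suc (suc k)) = cong (λ l → (0 , s) ∷ (s , suc s) ∷ tail l) (pathEdges≡pairs (suc s) (suc k))
  where tail : List (ℕ × ℕ) → List (ℕ × ℕ)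
        tail [] = []
        tail (_ ∷ l) = l

-- Bipartiteness

parity : ℕ → Bool
parity zero = false
parity (suc n) = not (parity n)

parity-+ : ∀ m n → parity (m + n) ≡ parity m xor parity n
parity-+ zero n = refl
parity-+ (suc m) n = trans (cong not (parity-+ m n)) (not-distribˡ-xor (parity m) (parity n))

parity-double : ∀ m → parity (m + m) ≡ false
parity-double m = trans (parity-+ m m) (xor-same (parity m))

Even : ℕ → Set
Even n = ∃ λ m → n ≡ m + m

parity-even : ∀ {n} → Even n → parity n ≡ false
parity-even (m , refl) = parity-double m

even⊎odd : ∀ n → Even n ⊎ (∃ λ m → n ≡ suc (m + m))
even⊎odd zero = inj₁ (0 , refl)
even⊎odd (suc n) with even⊎odd n
... | inj₁ (m , refl) = inj₂ (m , refl)
... | inj₂ (m , refl) = inj₁ (suc m , cong suc (sym (+-suc m m)))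

parity≡false⇒even : ∀ n → parity n ≡ false → Even n
parity≡false⇒even n p with even⊎odd n
... | inj₁ even = even
... | inj₂ (m , refl) with () ← trans (sym (cong not (parity-double m))) p

module _ (col : ℕ → Bool) where

  Proper : ℕ × ℕ → Set
  Proper e = col (proj₁ e) ≢ col (proj₂ e)

  proper-sequence-alternates : ∀ a l z → All Proper (pairs (a ∷ l ++ [ z ])) → col z ≡ parity (suc (length l)) xor col a
  proper-sequence-alternates a [] z (a≁z ∷ []) = ¬-not (≢-sym a≁z)
  proper-sequence-alternates a (b ∷ l) z (a≁b ∷ proper) = begin
    col z                                          ≡⟨ proper-sequence-alternates b l z proper ⟩
    parity (suc (length l)) xor col b              ≡⟨ cong (parity (suc (length l)) xor_) (¬-not (≢-sym a≁b)) ⟩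
    parity (suc (length l)) xor not (col a)        ≡⟨ not-distribʳ-xor (parity (suc (length l))) (col a) ⟨
    not (parity (suc (length l)) xor col a)        ≡⟨ not-distribˡ-xor (parity (suc (length l))) (col a) ⟩
    parity (suc (suc (length l))) xor col a        ∎

  proper-path-even : ∀ s k → col 0 ≢ col 1 → All Proper (pathEdges s k) → Even k
  proper-path-even s k 0≁1 proper = parity≡false⇒even k (¬-not k-not-odd)
    where
    ends : col 1 ≡ parity (suc k) xor col 0
    ends = subst (λ n → col 1 ≡ parity (suc n) xor col 0) (length-range s k)
             (proper-sequence-alternates 0 (range s k) 1 (subst (All Proper) (pathEdges≡pairs s k) proper))
    k-not-odd : parity k ≢ true
    k-not-odd p = 0≁1 (sym (trans ends (cong (λ b → not b xor col 0) p)))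

Γ-colour : ℕ → Bool
Γ-colour zero = true
Γ-colour (suc zero) = false
Γ-colour (suc (suc n)) = parity n

Γ-colour-path : ∀ q k → parity q ≡ false → parity k ≡ false → All (Proper Γ-colour) (pathEdges (2 + q) k)
Γ-colour-path q zero _ _ = (λ ()) ∷ []
Γ-colour-path q (suc n) q-even k-even =
  subst (All (Proper Γ-colour)) (sym (pathEdges≡pairs (2 + q) (suc n))) ((λ eq → true≢false (trans eq q-even)) ∷ alternating q n last-odd)
  where
  true≢false : true ≢ false
  true≢false ()
  alternating : ∀ q n → parity (q + n) ≡ true → All (Proper Γ-colour) (pairs (2 + q ∷ range (3 + q) n ++ [ 1 ]))
  alternating q zero p = (λ eq → true≢false (trans (sym (trans (cong parity (sym (+-identityʳ q))) p)) eq)) ∷ []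
  alternating q (suc n) p = not-¬ refl ∷ alternating (suc q) n (trans (cong parity (sym (+-suc q n))) p)
  last-odd : parity (q + n) ≡ true
  last-odd = trans (parity-+ q n) (trans (cong (_xor parity n) q-even) (trans (sym (not-involutive (parity n))) (cong not k-even)))

Γ-bipartite⇒even : ∀ b c d → Bipartite (Γ 0 b c d) → Even b × Even c × Even d
Γ-bipartite⇒even b c d (col , u≁v ∷ proper) =
  proper-path-even col 2 b u≁v (All.++⁻ˡ (pathEdges 2 b) proper) ,
  proper-path-even col (2 + b) c u≁v (All.++⁻ˡ (pathEdges (2 + b) c) (All.++⁻ʳ (pathEdges 2 b) proper)) ,
  proper-path-even col (2 + b + c) d u≁v (All.++⁻ʳ (pathEdges (2 + b) c) (All.++⁻ʳ (pathEdges 2 b) proper))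

Γ-even⇒bipartite : ∀ b c d → Even b → Even c → Even d → Bipartite (Γ 0 b c d)
Γ-even⇒bipartite b c d b-even c-even d-even = Γ-colour , (λ ()) ∷ All.++⁺ (Γ-colour-path 0 b refl (parity-even b-even))
  (All.++⁺ (Γ-colour-path b c (parity-even b-even) (parity-even c-even)) (Γ-colour-path (b + c) d b+c-even (parity-even d-even)))
  where
  b+c-even : parity (b + c) ≡ false
  b+c-even = trans (parity-+ b c) (cong₂ _xor_ (parity-even b-even) (parity-even c-even))

-- Placing the abstract circuits in Γ

-- A layout places the internal vertices of P at sP, …, sP + kP - 1, and so on.  The flipped
-- labelling (f = true) composes it with the symmetry exchanging u and v, which reads every
-- path backwards.
record Layout : Set where
  constructor layout
  field
    sP kP sX kX sY kY : ℕ

slot : Bool → ℕ → ℕ → ℕ → ℕ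
slot false s k j = s + j
slot true s k j = s + (k ∸ suc j)

uLabel wLabel : Bool → ℕ
uLabel false = 0
uLabel true = 1
wLabel false = 1
wLabel true = 0

label : Bool → Layout → Node → ℕ
label f π U = uLabel f
label f π W = wLabel f
label f (layout sP kP sX kX sY kY) (P j) = slot f sP kP j
label f (layout sP kP sX kX sY kY) (X j) = slot f sX kX j
label f (layout sP kP sX kX sY kY) (Y j) = slot f sY kY j

edgeLabel : Bool → Layout → Node × Node → ℕ × ℕ
edgeLabel f π (a , b) = norm (label f π a , label f π b)

edgeLabel-sym : ∀ f π a b → edgeLabel f π (a , b) ≡ edgeLabel f π (b , a)
edgeLabel-sym f π a b = norm-comm (label f π a) (label f π b)

edgeLabel-path : ∀ f π R s k → (∀ j → label f π (R j) ≡ slot f s k j) →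
                 map (edgeLabel f π) (pairs (pathWalk R k)) ↭ map norm (pathEdges s k)
edgeLabel-path f π R s k label-R =
  ↭-trans (↭-reflexive (trans (map-∘ (pairs (pathWalk R k))) (cong (map norm) (sym (pairs-map (label f π) (pathWalk R k))))))
  (↭-trans (↭-reflexive (cong (λ l → map norm (pairs l)) labelled)) (orient f))
  where
  labelled : map (label f π) (pathWalk R k) ≡ uLabel f ∷ map (slot f s k) (range 0 k) ++ [ wLabel f ]
  labelled = cong (uLabel f ∷_) (trans (map-++ (label f π) (run↑ R 0 k) [ W ])
               (cong (_++ [ wLabel f ]) (trans (sym (map-∘ (range 0 k))) (map-cong label-R (range 0 k)))))
  orient : ∀ f → map norm (pairs (uLabel f ∷ map (slot f s k) (range 0 k) ++ [ wLabel f ])) ↭ map norm (pathEdges s k)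
  orient false = ↭-reflexive (cong (map norm) (begin
    pairs (0 ∷ map (s +_) (range 0 k) ++ [ 1 ]) ≡⟨ cong (λ l → pairs (0 ∷ l ++ [ 1 ])) (map-+-range s 0 k) ⟩
    pairs (0 ∷ range (s + 0) k ++ [ 1 ])        ≡⟨ cong (λ z → pairs (0 ∷ range z k ++ [ 1 ])) (+-identityʳ s) ⟩
    pairs (0 ∷ range s k ++ [ 1 ])              ≡⟨ pathEdges≡pairs s k ⟨
    pathEdges s k                               ∎))
  orient true = ↭-trans (↭-reflexive (cong (λ l → map norm (pairs l)) (begin
    1 ∷ map (λ j → s + (k ∸ suc j)) (range 0 k) ++ [ 0 ] ≡⟨ cong (λ l → 1 ∷ l ++ [ 0 ]) (map-∸-range s k) ⟩
    1 ∷ reverse (range s k) ++ [ 0 ]                     ≡⟨ cong (_++ [ 0 ]) (reverse-++ (range s k) [ 1 ]) ⟨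
    reverse (range s k ++ [ 1 ]) ++ [ 0 ]                ≡⟨ unfold-reverse 0 (range s k ++ [ 1 ]) ⟨
    reverse (0 ∷ range s k ++ [ 1 ])                     ∎)))
    (↭-trans (map-pairs-reverse norm norm-comm (0 ∷ range s k ++ [ 1 ])) (↭-reflexive (cong (map norm) (sym (pathEdges≡pairs s k)))))

PlacedEdges : Layout → List (ℕ × ℕ)
PlacedEdges (layout sP kP sX kX sY kY) =
  map norm (pathEdges 2 0) ++ map norm (pathEdges sP kP) ++ map norm (pathEdges sX kX) ++ map norm (pathEdges sY kY)

edgeLabel-thetaEdges : ∀ f π → let open Layout π in map (edgeLabel f π) (thetaEdges kP kX kY) ↭ PlacedEdges π
edgeLabel-thetaEdges f π@(layout sP kP sX kX sY kY) =
  ↭-trans (↭-reflexive (SymmetricKey.κ-thetaEdges (edgeLabel f π) (edgeLabel-sym f π) kP kX kY))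
  (++⁺ (↭-reflexive (uw f)) (++⁺ (edgeLabel-path f π P sP kP (λ _ → refl))
    (++⁺ (edgeLabel-path f π X sX kX (λ _ → refl)) (edgeLabel-path f π Y sY kY (λ _ → refl)))))
  where uw : ∀ f → map (edgeLabel f π) (pairs (U ∷ [ W ])) ≡ map norm (pathEdges 2 0)
        uw false = refl
        uw true = refl

slot-bounds : ∀ f s k j → j < k → s ≤ slot f s k j × slot f s k j < s + k
slot-bounds false s k j j<k = m≤m+n s j , +-monoʳ-< s j<k
slot-bounds true s (suc k) j j<k = m≤m+n s _ , +-monoʳ-< s (s≤s (m∸n≤m k j))

slot-injective : ∀ f s k {j j′} → j < k → j′ < k → slot f s k j ≡ slot f s k j′ → j ≡ j′
slot-injective false s k _ _ eq = +-cancelˡ-≡ s _ _ eq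
slot-injective true s k {j} {j′} j<k j′<k eq = suc-injective (+-cancelˡ-≡ (k ∸ suc j) _ _ (begin
  k ∸ suc j + suc j    ≡⟨ m∸n+n≡m j<k ⟩
  k                    ≡⟨ m∸n+n≡m j′<k ⟨
  k ∸ suc j′ + suc j′  ≡⟨ cong (_+ suc j′) (+-cancelˡ-≡ s _ _ eq) ⟨
  k ∸ suc j + suc j′   ∎))

uLabel≤1 : ∀ f → uLabel f ≤ 1
uLabel≤1 false = z≤n
uLabel≤1 true = s≤s z≤n

wLabel≤1 : ∀ f → wLabel f ≤ 1
wLabel≤1 false = s≤s z≤n
wLabel≤1 true = z≤n

uLabel≢wLabel : ∀ f → uLabel f ≢ wLabel f
uLabel≢wLabel false ()
uLabel≢wLabel true ()

Apart : ℕ → ℕ → ℕ → ℕ → Set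
Apart s k s′ k′ = s + k ≤ s′ ⊎ s′ + k′ ≤ s

record WellPlaced (π : Layout) : Set where
  open Layout π
  field
    2≤sP : 2 ≤ sP
    2≤sX : 2 ≤ sX
    2≤sY : 2 ≤ sY
    P#X : Apart sP kP sX kX
    P#Y : Apart sP kP sY kY
    X#Y : Apart sX kX sY kY

module _ {π : Layout} (well-placed : WellPlaced π) (f : Bool) where
  open Layout π
  open WellPlaced well-placed

  private
    end≢slot : ∀ {n s k j} → n ≤ 1 → 2 ≤ s → j < k → n ≢ slot f s k j
    end≢slot {s = s} {k} {j} n≤1 2≤s j<k refl = <⇒≱ (s≤s n≤1) (≤-trans 2≤s (proj₁ (slot-bounds f s k j j<k)))

    slots-apart : ∀ {s₁ k₁ s₂ k₂ j₁ j₂} → Apart s₁ k₁ s₂ k₂ → j₁ < k₁ → j₂ < k₂ →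
                  slot f s₁ k₁ j₁ ≢ slot f s₂ k₂ j₂
    slots-apart {s₁} {k₁} {s₂} {k₂} {j₁} {j₂} apart j₁<k₁ j₂<k₂ eq
      with slot-bounds f s₁ k₁ j₁ j₁<k₁ | slot-bounds f s₂ k₂ j₂ j₂<k₂ | apart
    ... | _ , hi₁ | lo₂ , _ | inj₁ le = <⇒≱ (<-≤-trans hi₁ le) (subst (s₂ ≤_) (sym eq) lo₂)
    ... | lo₁ , _ | _ , hi₂ | inj₂ le = <⇒≱ (<-≤-trans hi₂ le) (subst (s₁ ≤_) eq lo₁)

  label-injective : ∀ a b → Valid kP kX kY a → Valid kP kX kY b → label f π a ≡ label f π b → a ≡ b
  label-injective U U _ _ _ = refl
  label-injective W W _ _ _ = refl
  label-injective U W _ _ eq = ⊥-elim (uLabel≢wLabel f eq)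
  label-injective W U _ _ eq = ⊥-elim (uLabel≢wLabel f (sym eq))
  label-injective U (P j) _ v eq = ⊥-elim (end≢slot (uLabel≤1 f) 2≤sP v eq)
  label-injective U (X j) _ v eq = ⊥-elim (end≢slot (uLabel≤1 f) 2≤sX v eq)
  label-injective U (Y j) _ v eq = ⊥-elim (end≢slot (uLabel≤1 f) 2≤sY v eq)
  label-injective W (P j) _ v eq = ⊥-elim (end≢slot (wLabel≤1 f) 2≤sP v eq)
  label-injective W (X j) _ v eq = ⊥-elim (end≢slot (wLabel≤1 f) 2≤sX v eq)
  label-injective W (Y j) _ v eq = ⊥-elim (end≢slot (wLabel≤1 f) 2≤sY v eq)
  label-injective (P j) U v _ eq = ⊥-elim (end≢slot (uLabel≤1 f) 2≤sP v (sym eq))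
  label-injective (X j) U v _ eq = ⊥-elim (end≢slot (uLabel≤1 f) 2≤sX v (sym eq))
  label-injective (Y j) U v _ eq = ⊥-elim (end≢slot (uLabel≤1 f) 2≤sY v (sym eq))
  label-injective (P j) W v _ eq = ⊥-elim (end≢slot (wLabel≤1 f) 2≤sP v (sym eq))
  label-injective (X j) W v _ eq = ⊥-elim (end≢slot (wLabel≤1 f) 2≤sX v (sym eq))
  label-injective (Y j) W v _ eq = ⊥-elim (end≢slot (wLabel≤1 f) 2≤sY v (sym eq))
  label-injective (P j) (P j′) v v′ eq = cong P (slot-injective f sP kP v v′ eq)
  label-injective (X j) (X j′) v v′ eq = cong X (slot-injective f sX kX v v′ eq)
  label-injective (Y j) (Y j′) v v′ eq = cong Y (slot-injective f sY kY v v′ eq)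
  label-injective (P j) (X j′) v v′ eq = ⊥-elim (slots-apart P#X v v′ eq)
  label-injective (P j) (Y j′) v v′ eq = ⊥-elim (slots-apart P#Y v v′ eq)
  label-injective (X j) (Y j′) v v′ eq = ⊥-elim (slots-apart X#Y v v′ eq)
  label-injective (X j) (P j′) v v′ eq = ⊥-elim (slots-apart P#X v′ v (sym eq))
  label-injective (Y j) (P j′) v v′ eq = ⊥-elim (slots-apart P#Y v′ v (sym eq))
  label-injective (Y j) (X j′) v v′ eq = ⊥-elim (slots-apart X#Y v′ v (sym eq))

  map-label-≢ : ∀ {xs ys} → All (Valid kP kX kY) xs → All (Valid kP kX kY) ys →
                Pointwise _≢_ xs ys → Pointwise _≢_ (map (label f π) xs) (map (label f π) ys)
  map-label-≢ [] [] [] = []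
  map-label-≢ (va ∷ vs) (vb ∷ ws) (a≢b ∷ ps) = (λ eq → a≢b (label-injective _ _ va vb eq)) ∷ map-label-≢ vs ws ps

traversals-same-length : ∀ {x w₁ w₂ kP kX kY} → Traverses x w₁ kP kX kY → Traverses x w₂ kP kX kY → length w₁ ≡ length w₂
traversals-same-length {x} {w₁} {w₂} t₁ t₂ = +-cancelʳ-≡ 1 _ _ (begin
  length w₁ + 1                                     ≡⟨ length-++ w₁ ⟨
  length (w₁ ++ [ x ])                              ≡⟨ length-pairs x (w₁ ++ [ x ]) ⟨
  length (pairs (x ∷ w₁ ++ [ x ]))                  ≡⟨ length-map (λ _ → tt) (pairs (x ∷ w₁ ++ [ x ])) ⟨
  length (map (λ _ → tt) (pairs (x ∷ w₁ ++ [ x ]))) ≡⟨ ↭-length (↭-trans (t₁ _ (λ _ _ → refl)) (↭-sym (t₂ _ (λ _ _ → refl)))) ⟩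
  length (map (λ _ → tt) (pairs (x ∷ w₂ ++ [ x ]))) ≡⟨ length-map (λ _ → tt) (pairs (x ∷ w₂ ++ [ x ])) ⟩
  length (pairs (x ∷ w₂ ++ [ x ]))                  ≡⟨ length-pairs x (w₂ ++ [ x ]) ⟩
  length (w₂ ++ [ x ])                              ≡⟨ length-++ w₂ ⟩
  length w₂ + 1                                     ∎)

AvoidingPair : Graph → ℕ → Set
AvoidingPair G y = Σ (List ℕ) λ ws₁ → Σ (List ℕ) λ ws₂ →
  EulerCircuit G y ws₁ × EulerCircuit G y ws₂ × Avoiding G ws₁ ws₂ × Avoiding G ws₂ ws₁

avoiding-pairs⇒HasAvoiding : ∀ {G} → (∀ x → x < n G → AvoidingPair G x) → HasAvoiding G 2
avoiding-pairs⇒HasAvoiding {G} pairs x x<n with pairs x x<n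
... | ws₁ , ws₂ , euler₁ , euler₂ , avoid₁₂ , avoid₂₁ = C , euler , avoiding
  where
  C : Fin 2 → List ℕ
  C zero = ws₁
  C (suc zero) = ws₂
  euler : ∀ i → EulerCircuit G x (C i)
  euler zero = euler₁
  euler (suc zero) = euler₂
  avoiding : ∀ i j → i ≢ j → Avoiding G (C i) (C j)
  avoiding zero zero i≢j = ⊥-elim (i≢j refl)
  avoiding zero (suc zero) _ = avoid₁₂
  avoiding (suc zero) zero _ = avoid₂₁
  avoiding (suc zero) (suc zero) i≢j = ⊥-elim (i≢j refl)

module _ (G : Graph) {π : Layout} (well-placed : WellPlaced π) (placed : PlacedEdges π ↭ map norm (edges G))
         {col : ℕ → Bool} (proper : ProperColouring G col) (f : Bool) where
  open Layout π

  placed-circuit : ∀ {x w} → Traverses x w kP kX kY → EulerCircuit G (label f π x) (map (label f π) w)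
  placed-circuit {x} {w} traverses =
    ↭-trans (↭-reflexive labelled) (↭-trans (traverses (edgeLabel f π) (edgeLabel-sym f π)) (↭-trans (edgeLabel-thetaEdges f π) placed))
    where
    labelled : map norm (steps (label f π x ∷ map (label f π) w ++ [ label f π x ])) ≡ map (edgeLabel f π) (pairs (x ∷ w ++ [ x ]))
    labelled = begin
        map norm (steps (label f π x ∷ map (label f π) w ++ [ label f π x ]))
      ≡⟨ cong (map norm) (steps≡pairs _) ⟩
        map norm (pairs (label f π x ∷ map (label f π) w ++ [ label f π x ]))
      ≡⟨ cong (λ l → map norm (pairs (label f π x ∷ l))) (map-++ (label f π) w [ x ]) ⟨
        map norm (pairs (map (label f π) (x ∷ w ++ [ x ])))
      ≡⟨ cong (map norm) (pairs-map (label f π) (x ∷ w ++ [ x ])) ⟩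
        map norm (map (λ e → label f π (proj₁ e) , label f π (proj₂ e)) (pairs (x ∷ w ++ [ x ])))
      ≡⟨ map-∘ (pairs (x ∷ w ++ [ x ])) ⟨
        map (edgeLabel f π) (pairs (x ∷ w ++ [ x ]))
      ∎

  placed-avoiding-pair : ∀ {x} → ThetaCircuits x kP kX kY → AvoidingPair G (label f π x)
  placed-avoiding-pair circuits =
    map (label f π) w₁ , map (label f π) w₂ , euler₁ , euler₂ ,
    avoiding-if-distinct G proper distinct (circuits-colours-agree G proper euler₁ euler₂) ,
    avoiding-if-distinct G proper (Pointwise.symmetric ≢-sym distinct) (circuits-colours-agree G proper euler₂ euler₁)
    where
    open ThetaCircuits circuits
    euler₁ = placed-circuit traverses₁
    euler₂ = placed-circuit traverses₂
    distinct : Pointwise _≢_ (map (label f π) w₁) (map (label f π) w₂)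
    distinct = map-label-≢ well-placed f valid₁ valid₂
                 (numbered-disjoint⇒≢ 0 w₁ w₂ (traversals-same-length {kP = kP} {kX} {kY} traverses₁ traverses₂) positionwise-distinct)

lower-half-circuits : ∀ {kP kX kY} i → suc i + suc i ≤ kP → 1 ≤ kX → 1 ≤ kY → (∀ e → e + 3 ≤ kP → e ≤ kX + kY) →
                      ThetaCircuits (P i) kP kX kY
lower-half-circuits {kP} {kX} {kY} i le 1≤kX 1≤kY short with m≤n⇒∃[o]m+o≡n le
... | zero , eq = subst (λ k → ThetaCircuits (P i) k kX kY) (trans (sym (centre i)) eq) (AtCentre.circuits i kX kY 1≤kX 1≤kY)
  where centre : ∀ i → suc i + suc i + 0 ≡ i + suc (suc i)
        centre = solve-∀
... | suc e , eq = subst (λ k → ThetaCircuits (P i) k kX kY) (trans (sym (below i e)) eq)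
                     (BelowCentre.circuits i e kX kY (short e (subst (e + 3 ≤_) (trans (excess i e) eq) (m≤n+m (e + 3) (i + i)))))
  where below : ∀ i e → suc i + suc i + suc e ≡ i + suc (suc (i + suc e))
        below = solve-∀
        excess : ∀ i e → i + i + (e + 3) ≡ suc i + suc i + suc e
        excess = solve-∀

even-path-lower-half : ∀ k y → Even k → y < k → ∃ λ f → ∃ λ i → suc i + suc i ≤ k × slot f 0 k i ≡ y
even-path-lower-half k y (m , k≡m+m) y<k with suc y + suc y ≤? k
... | yes le = false , y , le , refl
... | no ≰ = true , k ∸ suc y , lower , back
  where
  m≤y : m ≤ y
  m≤y with m ≤? y
  ... | yes m≤y = m≤y
  ... | no m≰y = ⊥-elim (≰ (subst (suc y + suc y ≤_) (sym k≡m+m) (+-mono-≤ (≰⇒> m≰y) (≰⇒> m≰y))))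
  1+[k∸1+y] : suc (k ∸ suc y) ≡ k ∸ y
  1+[k∸1+y] = sym (+-∸-assoc 1 y<k)
  back : k ∸ suc (k ∸ suc y) ≡ y
  back = trans (cong (k ∸_) 1+[k∸1+y]) (m∸[m∸n]≡n (<⇒≤ y<k))
  k∸y≤m : k ∸ y ≤ m
  k∸y≤m = subst (k ∸ y ≤_) (trans (cong (_∸ m) k≡m+m) (m+n∸n≡m m m)) (∸-monoʳ-≤ k m≤y)
  lower : suc (k ∸ suc y) + suc (k ∸ suc y) ≤ k
  lower = subst₂ (λ a z → a + a ≤ z) (sym 1+[k∸1+y]) (sym k≡m+m) (+-mono-≤ k∸y≤m k∸y≤m)

slot-shift : ∀ f s k i → slot f s k i ≡ s + slot f 0 k i
slot-shift false s k i = refl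
slot-shift true s k i = refl

module _ (G : Graph) {col : ℕ → Bool} (proper : ProperColouring G col) {π : Layout} (well-placed : WellPlaced π)
         (placed : PlacedEdges π ↭ map norm (edges G)) where
  open Layout π

  branch-avoiding-pair : kP ≤ kX → 1 ≤ kX → 1 ≤ kY → ∀ f → AvoidingPair G (uLabel f)
  branch-avoiding-pair kP≤kX 1≤kX 1≤kY f = placed-avoiding-pair G well-placed placed proper f (AtBranch.circuits kP kX kY kP≤kX 1≤kX 1≤kY)

  path-avoiding-pair : Even kP → 1 ≤ kX → 1 ≤ kY → (∀ e → e + 3 ≤ kP → e ≤ kX + kY) → ∀ y → y < kP → AvoidingPair G (sP + y)
  path-avoiding-pair even 1≤kX 1≤kY short y y<kP with even-path-lower-half kP y even y<kP
  ... | f , i , lower , at-y = subst (AvoidingPair G) (trans (slot-shift f sP kP i) (cong (sP +_) at-y))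
                                 (placed-avoiding-pair G well-placed placed proper f (lower-half-circuits i lower 1≤kX 1≤kY short))

-- Paths through vertices of degree two

-- seqVertex h s k q is the q-th entry of h, s, s + 1, …, s + k - 1, 1 (and 1 beyond it).
seqVertex : ℕ → ℕ → ℕ → ℕ → ℕ
seqVertex h s k zero = h
seqVertex h s zero (suc q) = 1
seqVertex h s (suc k) (suc zero) = s
seqVertex h s (suc k) (suc (suc q)) = seqVertex h (suc s) k (suc q)

seqVertex-head-irrelevant : ∀ h h′ s k q → seqVertex h s k (suc q) ≡ seqVertex h′ s k (suc q)
seqVertex-head-irrelevant h h′ s zero q = refl
seqVertex-head-irrelevant h h′ s (suc k) zero = refl
seqVertex-head-irrelevant h h′ s (suc k) (suc q) = seqVertex-head-irrelevant h h′ (suc s) k q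

∈-pairs-seq : ∀ h s k {a b} → (a , b) ∈ pairs (h ∷ range s k ++ [ 1 ]) →
              ∃ λ q → q ≤ k × a ≡ seqVertex h s k q × b ≡ seqVertex h s k (suc q)
∈-pairs-seq h s zero (here refl) = 0 , z≤n , refl , refl
∈-pairs-seq h s (suc k) (here refl) = 0 , z≤n , refl , refl
∈-pairs-seq h s (suc k) (there m) with ∈-pairs-seq s (suc s) k m
... | zero , _ , refl , refl = 1 , s≤s z≤n , refl , seqVertex-head-irrelevant s h (suc s) k 0
... | suc q , q≤k , refl , refl =
  suc (suc q) , s≤s q≤k , seqVertex-head-irrelevant s h (suc s) k q , seqVertex-head-irrelevant s h (suc s) k (suc q)

pathVertex : ℕ → ℕ → ℕ → ℕ
pathVertex = seqVertex 0

∈-pathEdges : ∀ s k {a b} → (a , b) ∈ pathEdges s k → ∃ λ q → q ≤ k × a ≡ pathVertex s k q × b ≡ pathVertex s k (suc q)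
∈-pathEdges s k m = ∈-pairs-seq 0 s k (subst (_ ∈_) (pathEdges≡pairs s k) m)

pathVertex-internal : ∀ s k q → q < k → pathVertex s k (suc q) ≡ s + q
pathVertex-internal s (suc k) zero _ = sym (+-identityʳ s)
pathVertex-internal s (suc k) (suc q) (s≤s q<k) =
  trans (seqVertex-head-irrelevant 0 0 (suc s) k q) (trans (pathVertex-internal (suc s) k q q<k) (sym (+-suc s q)))

pathVertex-end : ∀ s k q → k ≤ q → pathVertex s k (suc q) ≡ 1
pathVertex-end s zero q _ = refl
pathVertex-end s (suc k) (suc q) (s≤s k≤q) = pathVertex-end (suc s) k q k≤q

pathVertex-cases : ∀ s k q → pathVertex s k q ≡ 0 ⊎ pathVertex s k q ≡ 1 ⊎ (s ≤ pathVertex s k q × pathVertex s k q < s + k)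
pathVertex-cases s k zero = inj₁ refl
pathVertex-cases s k (suc q) with q <? k
... | yes q<k = inj₂ (inj₂ (subst (λ z → s ≤ z × z < s + k) (sym (pathVertex-internal s k q q<k)) (m≤m+n s q , +-monoʳ-< s q<k)))
... | no q≮k = inj₂ (inj₁ (pathVertex-end s k q (≮⇒≥ q≮k)))

pathVertex-index : ∀ s k q j → 2 ≤ s → j < k → pathVertex s k q ≡ s + j → q ≡ suc j
pathVertex-index s k zero j 2≤s j<k eq = ⊥-elim (<⇒≢ (≤-trans (s≤s z≤n) (≤-trans 2≤s (m≤m+n s j))) eq)
pathVertex-index s k (suc q) j 2≤s j<k eq with q <? k
... | yes q<k = cong suc (+-cancelˡ-≡ s _ _ (trans (sym (pathVertex-internal s k q q<k)) eq))
... | no q≮k = ⊥-elim (<⇒≢ (≤-trans (s≤s (s≤s z≤n)) (≤-trans 2≤s (m≤m+n s j))) (trans (sym (pathVertex-end s k q (≮⇒≥ q≮k))) eq))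

∉-pathEdges : ∀ s k s′ k′ j {a b} → 2 ≤ s → j < k → Apart s k s′ k′ → (a , b) ∈ pathEdges s′ k′ → a ≢ s + j × b ≢ s + j
∉-pathEdges s k s′ k′ j 2≤s j<k apart m with ∈-pathEdges s′ k′ m
... | q , _ , refl , refl = avoids q , avoids (suc q)
  where
  2≤s+j = ≤-trans 2≤s (m≤m+n s j)
  avoids : ∀ q → pathVertex s′ k′ q ≢ s + j
  avoids q eq with pathVertex-cases s′ k′ q
  ... | inj₁ ≡0 = <⇒≢ (≤-trans (s≤s z≤n) 2≤s+j) (trans (sym ≡0) eq)
  ... | inj₂ (inj₁ ≡1) = <⇒≢ 2≤s+j (trans (sym ≡1) eq)
  ... | inj₂ (inj₂ (lo , hi)) = outside apart
    where outside : Apart s k s′ k′ → ⊥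
          outside (inj₁ le) = <⇒≱ (<-≤-trans (+-monoʳ-< s j<k) le) (subst (s′ ≤_) eq lo)
          outside (inj₂ le) = <⇒≱ (<-≤-trans (subst (_< s′ + k′) eq hi) le) (m≤m+n s j)

pathEdges-at : ∀ s k j {a b} → 2 ≤ s → j < k → (a , b) ∈ pathEdges s k →
               (a ≡ s + j → b ≡ pathVertex s k (2 + j)) × (b ≡ s + j → a ≡ pathVertex s k j)
pathEdges-at s k j 2≤s j<k m with ∈-pathEdges s k m
... | q , _ , refl , refl = (λ eq → cong (λ z → pathVertex s k (suc z)) (pathVertex-index s k q j 2≤s j<k eq)) ,
                            (λ eq → cong (pathVertex s k) (suc-injective (pathVertex-index s k (suc q) j 2≤s j<k eq)))

OnPathOrAvoids : ℕ → ℕ → ℕ → ℕ × ℕ → Set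
OnPathOrAvoids s k j (a , a′) = (a , a′) ∈ pathEdges s k ⊎ (a ≢ s + j × a′ ≢ s + j)

record InternalPath (G : Graph) (s k : ℕ) : Set where
  field
    2≤s : 2 ≤ s
    on-path-or-avoids : ∀ j → j < k → ∀ {e} → e ∈ edges G → OnPathOrAvoids s k j e

module _ {G : Graph} {s k : ℕ} (path : InternalPath G s k) where
  open InternalPath path

  internal-neighbours : ∀ p z → 1 ≤ p → p ≤ k → Adj G (pathVertex s k p) z → z ≡ pathVertex s k (p ∸ 1) ⊎ z ≡ pathVertex s k (suc p)
  internal-neighbours (suc j) z _ j<k adj = neighbours (subst (λ x → Adj G x z) (pathVertex-internal s k j j<k) adj)
    where
    neighbours : Adj G (s + j) z → z ≡ pathVertex s k j ⊎ z ≡ pathVertex s k (2 + j)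
    neighbours (inj₁ m) with on-path-or-avoids j j<k m
    ... | inj₁ on = inj₂ (proj₁ (pathEdges-at s k j 2≤s j<k on) refl)
    ... | inj₂ (≢x , _) = ⊥-elim (≢x refl)
    neighbours (inj₂ m) with on-path-or-avoids j j<k m
    ... | inj₁ on = inj₁ (proj₂ (pathEdges-at s k j 2≤s j<k on) refl)
    ... | inj₂ (_ , ≢x) = ⊥-elim (≢x refl)

module _ (G : Graph) (pos : ℕ → ℕ) (k : ℕ)
         (neighbours : ∀ p z → 1 ≤ p → p ≤ k → Adj G (pos p) z → z ≡ pos (p ∸ 1) ⊎ z ≡ pos (suc p)) where

  private
    no-return : ∀ {p z r} → z ≡ pos (p ∸ 1) → Unique (norm (pos (p ∸ 1) , pos p) ∷ norm (pos p , z) ∷ r) → ⊥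
    no-return refl ((first≢second ∷ _) ∷ _) = first≢second (norm-comm _ _)

    p≤k : ∀ p n → p + suc n ≤ suc k → p ≤ k
    p≤k p n le = ≤-pred (≤-trans (s≤s (m≤m+n p n)) (subst (_≤ suc k) (+-suc p n) le))

  -- A trail entering the path at pos p from pos (p - 1) cannot turn back, so it runs on along the path.
  trail-follows-path : ∀ n p mid x → 1 ≤ p → p + n ≤ suc k →
    Unique (map norm (steps (pos (p ∸ 1) ∷ pos p ∷ mid ++ [ x ]))) →
    Walk G (pos (p ∸ 1) ∷ pos p ∷ mid ++ [ x ]) →
    (∀ q → p < q → q ≤ p + n → x ≢ pos q) →
    ∃ λ rest → mid ≡ map pos (range (suc p) n) ++ rest
  trail-follows-path zero p mid x _ _ _ _ _ = mid , refl
  trail-follows-path (suc n) p [] x 1≤p le trail walk x∉ with neighbours p x 1≤p (p≤k p n le) (walk (there (here refl)))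
  ... | inj₁ back = ⊥-elim (no-return back trail)
  ... | inj₂ on = ⊥-elim (x∉ (suc p) ≤-refl (subst (suc p ≤_) (sym (+-suc p n)) (s≤s (m≤m+n p n))) on)
  trail-follows-path (suc n) p (z ∷ mid) x 1≤p le trail walk x∉ with neighbours p z 1≤p (p≤k p n le) (walk (there (here refl)))
  ... | inj₁ back = ⊥-elim (no-return back trail)
  ... | inj₂ refl
    with trail-follows-path n (suc p) mid x (s≤s z≤n) (subst (_≤ suc k) (+-suc p n) le) (AllPairs.tail trail)
           (λ m → walk (there m)) (λ q p<q q≤ → x∉ q (<-trans (n<1+n p) p<q) (subst (q ≤_) (sym (+-suc p n)) q≤))
  ... | rest , eq = rest , cong (pos (suc p) ∷_) eq

module _ {G : Graph} (simple : Simple G) where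

  simple-circuit-nonempty : ∀ {x ws} → EulerCircuit G x ws → ∃ λ f → ∃ λ r → ws ≡ f ∷ r
  simple-circuit-nonempty {x} {[]} euler with circuit-walk G {x} {[]} euler (here refl)
  ... | inj₁ loop = ⊥-elim (lookup (proj₁ simple) loop refl)
  ... | inj₂ loop = ⊥-elim (lookup (proj₁ simple) loop refl)
  simple-circuit-nonempty {x} {f ∷ r} euler = f , r , refl

  -- All circuits at x start at one of its at most two neighbours, and avoiding ones at different ones.
  av≤2-at-degree-two : ∀ {x u v} → x < n G → (∀ z → Adj G x z → z ≡ u ⊎ z ≡ v) → ∀ k → HasAvoiding G k → k ≤ 2
  av≤2-at-degree-two _ _ zero _ = z≤n
  av≤2-at-degree-two _ _ (suc zero) _ = s≤s z≤n
  av≤2-at-degree-two _ _ (suc (suc zero)) _ = ≤-refl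
  av≤2-at-degree-two {x} {u} {v} x<n nbrs (suc (suc (suc k))) avoid =
    ⊥-elim (pigeonhole (first-at 0F) (first-at 1F) (first-at 2F) (firsts-differ 0F 1F (λ ())) (firsts-differ 0F 2F (λ ())) (firsts-differ 1F 2F (λ ())))
    where
    0F 1F 2F : Fin (3 + k)
    0F = zero
    1F = suc zero
    2F = suc (suc zero)
    C = proj₁ (avoid x x<n)
    euler = proj₁ (proj₂ (avoid x x<n))
    avoiding = proj₂ (proj₂ (avoid x x<n))
    first : Fin (3 + k) → ℕ
    first i = proj₁ (simple-circuit-nonempty (euler i))
    C′ : Fin (3 + k) → List ℕ
    C′ i = first i ∷ proj₁ (proj₂ (simple-circuit-nonempty (euler i)))
    C≡ : ∀ i → C i ≡ C′ i
    C≡ i = proj₂ (proj₂ (simple-circuit-nonempty (euler i)))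
    first-at : ∀ i → first i ≡ u ⊎ first i ≡ v
    first-at i = nbrs (first i) (circuit-walk G {x} {C′ i} (subst (EulerCircuit G x) (C≡ i) (euler i)) (here refl))
    firsts-differ : ∀ i j → i ≢ j → first i ≢ first j
    firsts-differ i j i≢j with subst₂ (Avoiding G) (C≡ i) (C≡ j) (avoiding i j i≢j)
    ... | (≢ , _) ∷ _ = ≢
    pigeonhole : ∀ {a b c} → (a ≡ u ⊎ a ≡ v) → (b ≡ u ⊎ b ≡ v) → (c ≡ u ⊎ c ≡ v) → a ≢ b → a ≢ c → b ≢ c → ⊥
    pigeonhole (inj₁ refl) (inj₁ refl) _ a≢b _ _ = a≢b refl
    pigeonhole (inj₂ refl) (inj₂ refl) _ a≢b _ _ = a≢b refl
    pigeonhole (inj₁ refl) _ (inj₁ refl) _ a≢c _ = a≢c refl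
    pigeonhole (inj₂ refl) _ (inj₂ refl) _ a≢c _ = a≢c refl
    pigeonhole _ (inj₁ refl) (inj₁ refl) _ _ b≢c = b≢c refl
    pigeonhole _ (inj₂ refl) (inj₂ refl) _ _ b≢c = b≢c refl

lastPointwise : ∀ {R : ℕ → ℕ → Set} (f g : ℕ → ℕ) a n {r r′} →
                Pointwise R (map f (range a (suc n)) ++ r) (map g (range a (suc n)) ++ r′) → R (f (a + n)) (g (a + n))
lastPointwise {R} f g a zero (p ∷ _) = subst (λ z → R (f z) (g z)) (sym (+-identityʳ a)) p
lastPointwise {R} f g a (suc n) (_ ∷ ps) = subst (λ z → R (f z) (g z)) (sym (+-suc a n)) (lastPointwise f g (suc a) n ps)

module _ {G : Graph} (simple : Simple G) (u~v : Adj G 0 1) {s m : ℕ} (path : InternalPath G s (suc (m + m))) where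
  open InternalPath path

  private
    k x : ℕ
    k = suc (m + m)
    x = s + m

    pos pos′ : ℕ → ℕ
    pos = pathVertex s k
    pos′ q = pos (suc k ∸ q)

    m<k : m < k
    m<k = s≤s (m≤m+n m m)

    pos-middle : pos (suc m) ≡ x
    pos-middle = pathVertex-internal s k m m<k

    pos′-middle : pos′ (suc m) ≡ x
    pos′-middle = trans (cong pos (trans (+-∸-assoc 1 (m≤m+n m m)) (cong suc (m+n∸n≡m m m)))) pos-middle

    pos′-below : pos′ (2 + m) ≡ pos m
    pos′-below = cong pos (m+n∸n≡m m m)

    N = internal-neighbours path

    N′ : ∀ p z → 1 ≤ p → p ≤ k → Adj G (pos′ p) z → z ≡ pos′ (p ∸ 1) ⊎ z ≡ pos′ (suc p)
    N′ (suc p) z _ p<k adj with N (k ∸ p) z (m<n⇒0<n∸m p<k) (m∸n≤m k p) adj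
    ... | inj₁ eq = inj₂ (trans eq (cong pos (trans (∸-+-assoc k p 1) (cong (k ∸_) (+-comm p 1)))))
    ... | inj₂ eq = inj₁ (trans eq (cong pos (sym (+-∸-assoc 1 (≤-trans (n≤1+n p) p<k)))))

    trail : ∀ {ws} → EulerCircuit G x ws → Unique (map norm (steps (x ∷ ws ++ [ x ])))
    trail euler = unique-resp-↭ (↭-sym euler) (proj₂ simple)

    follow-up : ∀ r → EulerCircuit G x (pos (2 + m) ∷ r) → ∃ λ rest → r ≡ map pos (range (3 + m) m) ++ rest
    follow-up r euler = trail-follows-path G pos k N m (2 + m) r x (s≤s z≤n) ≤-refl
      (subst (λ w → Unique (map norm (steps (w ∷ pos (2 + m) ∷ r ++ [ x ])))) (sym pos-middle) (trail {pos (2 + m) ∷ r} euler))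
      (subst (λ w → Walk G (w ∷ pos (2 + m) ∷ r ++ [ x ])) (sym pos-middle) (circuit-walk G {x} {pos (2 + m) ∷ r} euler))
      (λ q 2+m<q _ eq → 1+n≰n (≤-trans (n≤1+n (2 + m)) (subst (2 + m <_) (pathVertex-index s k q m 2≤s m<k (sym eq)) 2+m<q)))

    follow-down : ∀ r → EulerCircuit G x (pos′ (2 + m) ∷ r) → ∃ λ rest → r ≡ map pos′ (range (3 + m) m) ++ rest
    follow-down r euler = trail-follows-path G pos′ k N′ m (2 + m) r x (s≤s z≤n) ≤-refl
      (subst (λ w → Unique (map norm (steps (w ∷ pos′ (2 + m) ∷ r ++ [ x ])))) (sym pos′-middle) (trail {pos′ (2 + m) ∷ r} euler))
      (subst (λ w → Walk G (w ∷ pos′ (2 + m) ∷ r ++ [ x ])) (sym pos′-middle) (circuit-walk G {x} {pos′ (2 + m) ∷ r} euler))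
      x∉
      where
      x∉ : ∀ q → 2 + m < q → q ≤ 2 + m + m → x ≢ pos′ q
      x∉ q 2+m<q q≤ eq = 1+n≰n (≤-trans (n≤1+n (2 + m)) (subst (2 + m <_) q≡1+m 2+m<q))
        where
        k∸q≡ : suc k ∸ q ≡ suc m
        k∸q≡ = pathVertex-index s k (suc k ∸ q) m 2≤s m<k (sym eq)
        q≡1+m : q ≡ suc m
        q≡1+m = +-cancelʳ-≡ (suc m) _ _ (trans (cong (q +_) (sym k∸q≡)) (trans (m+[n∸m]≡n q≤) (double m)))
          where double : ∀ m → suc (suc (m + m)) ≡ suc m + suc m
                double = solve-∀

    pos-top : pos (2 + m + m) ≡ 1
    pos-top = pathVertex-end s k k ≤-refl

    pos′-bottom : pos′ (2 + m + m) ≡ 0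
    pos′-bottom = cong pos (n∸n≡0 k)

    Direction : List ℕ → Set
    Direction ws = (∃ λ r → ws ≡ pos (2 + m) ∷ r) ⊎ (∃ λ r → ws ≡ pos′ (2 + m) ∷ r)

    direction : ∀ {ws} → EulerCircuit G x ws → Direction ws
    direction {ws} euler with simple-circuit-nonempty {G} simple {x} {ws} euler
    ... | f , r , refl with N (suc m) f (s≤s z≤n) m<k (subst (λ w → Adj G w f) (sym pos-middle) (circuit-walk G {x} {f ∷ r} euler (here refl)))
    ...   | inj₁ down = inj₂ (r , cong (_∷ r) (trans down (sym pos′-below)))
    ...   | inj₂ up = inj₁ (r , cong (_∷ r) up)

    up-down : ∀ ra rb → EulerCircuit G x (pos (2 + m) ∷ ra) → EulerCircuit G x (pos′ (2 + m) ∷ rb) →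
              Avoiding G (pos (2 + m) ∷ ra) (pos′ (2 + m) ∷ rb) → ⊥
    up-down ra rb up down avoiding with follow-up ra up | follow-down rb down
    ... | _ , refl | _ , refl = proj₂ (lastPointwise pos pos′ (2 + m) m avoiding) (subst₂ (Adj G) (sym pos-top) (sym pos′-bottom) v~u)
      where v~u : Adj G 1 0
            v~u = ⊎-swap u~v

    down-up : ∀ ra rb → EulerCircuit G x (pos (2 + m) ∷ ra) → EulerCircuit G x (pos′ (2 + m) ∷ rb) →
              Avoiding G (pos′ (2 + m) ∷ rb) (pos (2 + m) ∷ ra) → ⊥
    down-up ra rb up down avoiding with follow-up ra up | follow-down rb down
    ... | _ , refl | _ , refl = proj₂ (lastPointwise pos′ pos (2 + m) m avoiding) (subst₂ (Adj G) (sym pos′-bottom) (sym pos-top) u~v)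

  middle-no-avoiding-pair : ∀ {ws₁ ws₂} → EulerCircuit G x ws₁ → EulerCircuit G x ws₂ → Avoiding G ws₁ ws₂ → ⊥
  middle-no-avoiding-pair euler₁ euler₂ avoiding with direction euler₁ | direction euler₂
  ... | inj₁ (_ , refl) | inj₁ (_ , refl) with avoiding
  ...   | (≢ , _) ∷ _ = ≢ refl
  middle-no-avoiding-pair euler₁ euler₂ avoiding | inj₂ (_ , refl) | inj₂ (_ , refl) with avoiding
  ...   | (≢ , _) ∷ _ = ≢ refl
  middle-no-avoiding-pair euler₁ euler₂ avoiding | inj₁ (ra , refl) | inj₂ (rb , refl) = up-down ra rb euler₁ euler₂ avoiding
  middle-no-avoiding-pair euler₁ euler₂ avoiding | inj₂ (rb , refl) | inj₁ (ra , refl) = down-up ra rb euler₂ euler₁ avoiding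

internal-path-even : ∀ {G s k} → Simple G → Adj G 0 1 → InternalPath G s k → s + k ≤ n G → HasAvoiding G 2 → Even k
internal-path-even {G} {s} {k} simple u~v path s+k≤n avoid with even⊎odd k
... | inj₁ even = even
... | inj₂ (m , refl) with avoid (s + m) (<-≤-trans (+-monoʳ-< s (s≤s (m≤m+n m m))) s+k≤n)
...   | C , euler , avoiding = ⊥-elim (middle-no-avoiding-pair simple u~v path (euler zero) (euler (suc zero)) (avoiding zero (suc zero) (λ ())))

-- The graph Γ(0, b, c, d)

-- b = 0 would make the path B a second edge uv.
Γ-simple⇒1≤b : ∀ b c d → Simple (Γ 0 b c d) → 1 ≤ b
Γ-simple⇒1≤b zero c d (_ , (uv≢uv ∷ _) ∷ _) = ⊥-elim (uv≢uv refl)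
Γ-simple⇒1≤b (suc b) c d _ = s≤s z≤n

module Γ-properties (b c d : ℕ) where
  G : Graph
  G = Γ 0 b c d

  eB eC eD eUV : List (ℕ × ℕ)
  eUV = map norm (pathEdges 2 0)
  eB = map norm (pathEdges 2 b)
  eC = map norm (pathEdges (2 + b) c)
  eD = map norm (pathEdges (2 + b + c) d)

  edges≡ : map norm (edges G) ≡ eUV ++ eB ++ eC ++ eD
  edges≡ = trans (map-++ norm (pathEdges 2 0) _) (cong (eUV ++_)
           (trans (map-++ norm (pathEdges 2 b) _) (cong (eB ++_) (map-++ norm (pathEdges (2 + b) c) _))))

  layoutB layoutC layoutD : Layout
  layoutB = layout 2 b (2 + b) c (2 + b + c) d
  layoutC = layout (2 + b) c 2 b (2 + b + c) d
  layoutD = layout (2 + b + c) d 2 b (2 + b) c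

  placedB : PlacedEdges layoutB ↭ map norm (edges G)
  placedB = ↭-reflexive (sym edges≡)

  placedC : PlacedEdges layoutC ↭ map norm (edges G)
  placedC = ↭-trans (solve 4 (λ uv x y z → uv ⊕ y ⊕ x ⊕ z ⊜ uv ⊕ x ⊕ y ⊕ z) ↭-refl eUV eB eC eD) placedB
    where open import Algebra.Solver.CommutativeMonoid (++-commutativeMonoid {A = ℕ × ℕ}) using (solve; _⊜_; _⊕_)

  placedD : PlacedEdges layoutD ↭ map norm (edges G)
  placedD = ↭-trans (solve 4 (λ uv x y z → uv ⊕ z ⊕ x ⊕ y ⊜ uv ⊕ x ⊕ y ⊕ z) ↭-refl eUV eB eC eD) placedB
    where open import Algebra.Solver.CommutativeMonoid (++-commutativeMonoid {A = ℕ × ℕ}) using (solve; _⊜_; _⊕_)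

  2≤2+b+c : 2 ≤ 2 + b + c
  2≤2+b+c = ≤-trans (m≤m+n 2 b) (m≤m+n (2 + b) c)

  well-placedB : WellPlaced layoutB
  well-placedB = record { 2≤sP = ≤-refl ; 2≤sX = m≤m+n 2 b ; 2≤sY = 2≤2+b+c
                        ; P#X = inj₁ ≤-refl ; P#Y = inj₁ (m≤m+n (2 + b) c) ; X#Y = inj₁ ≤-refl }

  well-placedC : WellPlaced layoutC
  well-placedC = record { 2≤sP = m≤m+n 2 b ; 2≤sX = ≤-refl ; 2≤sY = 2≤2+b+c
                        ; P#X = inj₂ ≤-refl ; P#Y = inj₁ ≤-refl ; X#Y = inj₁ (m≤m+n (2 + b) c) }

  well-placedD : WellPlaced layoutD
  well-placedD = record { 2≤sP = 2≤2+b+c ; 2≤sX = ≤-refl ; 2≤sY = m≤m+n 2 b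
                        ; P#X = inj₂ (m≤m+n (2 + b) c) ; P#Y = inj₂ ≤-refl ; X#Y = inj₁ ≤-refl }

  private
    off-path : ∀ {s k} s′ k′ → 2 ≤ s → Apart s k s′ k′ → ∀ j → j < k → ∀ {e} → e ∈ pathEdges s′ k′ → OnPathOrAvoids s k j e
    off-path {s} {k} s′ k′ 2≤s ap j j<k m = inj₂ (∉-pathEdges s k s′ k′ j 2≤s j<k ap m)

  path-B : InternalPath G 2 b
  path-B = record { 2≤s = ≤-refl ; on-path-or-avoids = on }
    where
    on : ∀ j → j < b → ∀ {e} → e ∈ edges G → OnPathOrAvoids 2 b j e
    on j j<b m with ∈-++⁻ (pathEdges 2 0) m
    ... | inj₁ m′ = off-path 2 0 ≤-refl (inj₂ ≤-refl) j j<b m′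
    ... | inj₂ m′ with ∈-++⁻ (pathEdges 2 b) m′
    ... | inj₁ own = inj₁ own
    ... | inj₂ m″ with ∈-++⁻ (pathEdges (2 + b) c) m″
    ... | inj₁ m‴ = off-path (2 + b) c ≤-refl (inj₁ ≤-refl) j j<b m‴
    ... | inj₂ m‴ = off-path (2 + b + c) d ≤-refl (inj₁ (m≤m+n (2 + b) c)) j j<b m‴

  path-C : InternalPath G (2 + b) c
  path-C = record { 2≤s = m≤m+n 2 b ; on-path-or-avoids = on }
    where
    on : ∀ j → j < c → ∀ {e} → e ∈ edges G → OnPathOrAvoids (2 + b) c j e
    on j j<c m with ∈-++⁻ (pathEdges 2 0) m
    ... | inj₁ m′ = off-path 2 0 (m≤m+n 2 b) (inj₂ (m≤m+n 2 b)) j j<c m′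
    ... | inj₂ m′ with ∈-++⁻ (pathEdges 2 b) m′
    ... | inj₁ m″ = off-path 2 b (m≤m+n 2 b) (inj₂ ≤-refl) j j<c m″
    ... | inj₂ m″ with ∈-++⁻ (pathEdges (2 + b) c) m″
    ... | inj₁ own = inj₁ own
    ... | inj₂ m‴ = off-path (2 + b + c) d (m≤m+n 2 b) (inj₁ ≤-refl) j j<c m‴

  path-D : InternalPath G (2 + b + c) d
  path-D = record { 2≤s = 2≤2+b+c ; on-path-or-avoids = on }
    where
    on : ∀ j → j < d → ∀ {e} → e ∈ edges G → OnPathOrAvoids (2 + b + c) d j e
    on j j<d m with ∈-++⁻ (pathEdges 2 0) m
    ... | inj₁ m′ = off-path 2 0 2≤2+b+c (inj₂ 2≤2+b+c) j j<d m′
    ... | inj₂ m′ with ∈-++⁻ (pathEdges 2 b) m′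
    ... | inj₁ m″ = off-path 2 b 2≤2+b+c (inj₂ (m≤m+n (2 + b) c)) j j<d m″
    ... | inj₂ m″ with ∈-++⁻ (pathEdges (2 + b) c) m″
    ... | inj₁ m‴ = off-path (2 + b) c 2≤2+b+c (inj₂ ≤-refl) j j<d m‴
    ... | inj₂ own = inj₁ own

  u~v : Adj G 0 1
  u~v = inj₁ (here refl)

  av≤2 : Simple G → ∀ j → HasAvoiding G j → j ≤ 2
  av≤2 simple = av≤2-at-degree-two simple (s≤s (s≤s (≤-trans 1≤b (≤-trans (m≤m+n b c) (m≤m+n (b + c) d))))) neighbours
    where
    1≤b = Γ-simple⇒1≤b b c d simple
    neighbours : ∀ z → Adj G 2 z → z ≡ pathVertex 2 b 0 ⊎ z ≡ pathVertex 2 b 2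
    neighbours z adj =
      internal-neighbours path-B 1 z (s≤s z≤n) 1≤b (subst (λ x → Adj G x z) (sym (pathVertex-internal 2 b 0 1≤b)) adj)

  avoiding⇒even : Simple G → HasAvoiding G 2 → Even b × Even c × Even d
  avoiding⇒even simple avoid =
    internal-path-even simple u~v path-B (+-monoʳ-≤ 2 (≤-trans (m≤m+n b c) (m≤m+n (b + c) d))) avoid ,
    internal-path-even simple u~v path-C (s≤s (s≤s (m≤m+n (b + c) d))) avoid ,
    internal-path-even simple u~v path-D ≤-refl avoid

  bipartite⇒avoiding-pairs : b ≤ c → c ≤ d → 1 ≤ b → d < b + c + 3 → Bipartite G → ∀ x → x < n G → AvoidingPair G x
  bipartite⇒avoiding-pairs b≤c c≤d 1≤b d<b+c+3 (col , proper) = pair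
    where
    1≤c = ≤-trans 1≤b b≤c
    1≤d = ≤-trans 1≤c c≤d
    even = Γ-bipartite⇒even b c d (col , proper)
    shortB : ∀ e → e + 3 ≤ b → e ≤ c + d
    shortB e le = ≤-trans (m≤m+n e 3) (≤-trans le (≤-trans b≤c (m≤m+n c d)))
    shortC : ∀ e → e + 3 ≤ c → e ≤ b + d
    shortC e le = ≤-trans (m≤m+n e 3) (≤-trans le (≤-trans c≤d (m≤n+m d b)))
    shortD : ∀ e → e + 3 ≤ d → e ≤ b + c
    shortD e le = <⇒≤ (+-cancelʳ-≤ 3 (suc e) (b + c) (≤-<-trans le d<b+c+3))
    pair : ∀ x → x < n G → AvoidingPair G x
    pair zero _ = branch-avoiding-pair G proper well-placedB placedB b≤c 1≤c 1≤d false
    pair (suc zero) _ = branch-avoiding-pair G proper well-placedB placedB b≤c 1≤c 1≤d true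
    pair (suc (suc y)) (s≤s (s≤s y<b+c+d)) with y <? b
    ... | yes y<b = path-avoiding-pair G proper well-placedB placedB (proj₁ even) 1≤c 1≤d shortB y y<b
    ... | no y≮b with m≤n⇒∃[o]m+o≡n (≮⇒≥ y≮b)
    ...   | y₁ , refl with y₁ <? c
    ...     | yes y₁<c = path-avoiding-pair G proper well-placedC placedC (proj₁ (proj₂ even)) 1≤b 1≤d shortC y₁ y₁<c
    ...     | no y₁≮c with m≤n⇒∃[o]m+o≡n (≮⇒≥ y₁≮c)
    ...       | y₂ , refl = subst (λ z → AvoidingPair G (2 + z)) (+-assoc b c y₂)
                  (path-avoiding-pair G proper well-placedD placedD (proj₂ (proj₂ even)) 1≤b 1≤c shortD y₂
                    (+-cancelˡ-< (b + c) y₂ d (subst (_< b + c + d) (sym (+-assoc b c y₂)) y<b+c+d)))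

theorem7 : (b c d : ℕ) → b ≤ c → c ≤ d → Simple (Γ 0 b c d) → d < b + c + 3 →
    (AvIndex (Γ 0 b c d) 2 ⇔ Bipartite (Γ 0 b c d))
theorem7 b c d b≤c c≤d simple d<b+c+3 = mk⇔ av-2⇒bipartite bipartite⇒av-2
  where
  open Γ-properties b c d
  av-2⇒bipartite : AvIndex G 2 → Bipartite G
  av-2⇒bipartite (avoid , _) with avoiding⇒even simple avoid
  ... | even-b , even-c , even-d = Γ-even⇒bipartite b c d even-b even-c even-d
  bipartite⇒av-2 : Bipartite G → AvIndex G 2
  bipartite⇒av-2 bipartite =
    avoiding-pairs⇒HasAvoiding (bipartite⇒avoiding-pairs b≤c c≤d (Γ-simple⇒1≤b b c d simple) d<b+c+3 bipartite) ,
    av≤2 simple
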